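{- Let $q=2^r$. We have the following. (a) For even $n\ge2$ and all $q$, the map $\mathbb{F}_q\to C(DC_1^+(n,q))^\perp$, $a\mapsto c_1^+(a)$, is an $\mathbb{F}_2$-linear isomorphism. (b) For even $n\ge4$ and all $q$, or for $n=2$ and $q\ge4$, the map $\mathbb{F}_q\to C(DC_2^+(n,q))^\perp$, $a\mapsto c_2^+(a)$, is an $\mathbb{F}_2$-linear isomorphism. (c) For odd $n\ge3$ and all $q$, or for $n=1$ and $q\ge8$, the map $\mathbb{F}_q\to C(DC_1^-(n,q))^\perp$, $a\mapsto c_1^-(a)$, is an $\mathbb{F}_2$-linear isomorphism. (d) For odd $n\ge3$ and all $q$, the map $\mathbb{F}_q\to C(DC_2^-(n,q))^\perp$, $a\mapsto c_2^-(a)$, is an $\mathbb{F}_2$-linear isomorphism.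
   Context: Let $q=2^r$ and let $\mathbb{F}_q$ be the field with $q$ elements. Let $tr(x)=x+x^2+\cdots+x^{2^{r-1}}$ be the absolute trace to $\mathbb{F}_2$, and let $Tr$ be the matrix trace. $O^+(2n,q)$ is the group of $g\in GL(2n,q)$ preserving $\theta^+(x)=\sum_{i=1}^nx_ix_{n+i}$. $P^+=P^+(2n,q)$ is the subgroup of all products $\begin{bmatrix}A&0\\0&{}^tA^{ -1}\end{bmatrix}\begin{bmatrix}1_n&B\\0&1_n\end{bmatrix}$ with $A\in GL(n,q)$ and $B$ an $n\times n$ symmetric matrix with zero diagonal. For $0\le s\le n$, $\sigma_s^+$ is the $2n\times2n$ matrix which, in block form for $2n=s+(n-s)+s+(n-s)$, is $\begin{bmatrix}0&0&1_s&0\\0&1_{n-s}&0&0\\1_s&0&0&0\\0&0&0&1_{n-s}\end{bmatrix}$. The double cosets are: - $DC_1^+(n,q)=P^+\sigma_{n-1}^+P^+$ and $DC_2^+(n,q)=P^+\sigma_{n-2}^+P^+$ for even $n\ge2$; - $DC_1^-(n,q)=P^+\sigma_{n-1}^+P^+$ for odd $n\ge1$; - $DC_2^-(n,q)=P^+\sigma_{n-2}^+P^+$ for odd $n\ge3$. For each such double coset $D=DC_i^\pm(n,q)$, let $N=|D|$ and fix an ordering $g_1,\dots,g_N$ of its elements. The binary code is $C(D)=\{u\in\mathbb{F}_2^N:\sum_{j=1}^Nu_j\,Tr\,g_j=0\text{ in }\mathbb{F}_q\}$. Let $C(D)^\perp$ be its dual code in $\mathbb{F}_2^N$ with respect to the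 standard dot product. By Delsarte's theorem, $C(D)^\perp$ equals the set of vectors $c_i^\pm(a)=(tr(a\,Tr\,g_1),\dots,tr(a\,Tr\,g_N))$ for $a\in\mathbb{F}_q$. -}

module Defs where

open import Level using (0ℓ)
open import Data.Nat as ℕ using (ℕ; zero; suc; _^_)
open import Data.Fin using (Fin; toℕ; zero; suc)
import Data.Fin
import Data.Sum
open import Data.Bool using (Bool; true; false; not; _∧_; _xor_; if_then_else_)
open import Data.Vec using (Vec)
open import Data.Vec.Relation.Unary.Unique.Propositional using (Unique)
open import Data.Vec.Membership.Propositional using (_∈_)
open import Data.Product using (Σ; ∃; _×_; _,_)
open import Relation.Binary.PropositionalEquality using (_≡_; _≢_)
open import Relation.Nullary using (¬_; Dec; yes; no)
open import Relation.Nullary.Decidable using (⌊_⌋)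
open import Algebra.Structures using (IsCommutativeRing)

-- A finite field with q = 2^r elements (equality is propositional).
-- Any two such fields are isomorphic, so quantifying over all of them
-- is the same as speaking of "the" field F_q.

record FiniteField2 (r : ℕ) : Set₁ where
  field
    Carrier : Set
    _+_ _*_ : Carrier → Carrier → Carrier
    -_      : Carrier → Carrier
    0# 1#   : Carrier
    isCommutativeRing : IsCommutativeRing _≡_ _+_ _*_ -_ 0# 1#
    0≢1     : 0# ≢ 1#
    inverse : ∀ x → x ≢ 0# → Σ Carrier λ y → x * y ≡ 1#
    _≟_     : (x y : Carrier) → Dec (x ≡ y)
    char2   : 1# + 1# ≡ 0#
    elements : Vec Carrier (2 ^ r)
    elements-unique : Unique elements
    elements-complete : ∀ x → x ∈ elements

module FF {r : ℕ} (F : FiniteField2 r) where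
  open FiniteField2 F public

  pow : Carrier → ℕ → Carrier
  pow x zero = 1#
  pow x (suc k) = x * pow x k

  sumF : (N : ℕ) → (Fin N → Carrier) → Carrier
  sumF zero f = 0#
  sumF (suc N) f = f zero + sumF N (λ j → f (suc j))

  tr : Carrier → Carrier
  tr x = sumF r (λ i → pow x (2 ^ toℕ i))

  ι : Bool → Carrier
  ι true = 1#
  ι false = 0#

  -- an element of F_q lying in F_2, read as a bit (true iff ≠ 0)
  bit : Carrier → Bool
  bit x = not ⌊ x ≟ 0# ⌋

  Mat : ℕ → Set
  Mat m = Fin m → Fin m → Carrier

  _≡ₘ_ : {m : ℕ} → Mat m → Mat m → Set
  M ≡ₘ M' = ∀ i j → M i j ≡ M' i j

  _·_ : {m : ℕ} → Mat m → Mat m → Mat m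
  _·_ {m} M M' i j = sumF m (λ k → M i k * M' k j)

  transpose : {m : ℕ} → Mat m → Mat m
  transpose M i j = M j i

  δ : {m : ℕ} → Fin m → Fin m → Carrier
  δ i j with toℕ i ℕ.≟ toℕ j
  ... | yes _ = 1#
  ... | no  _ = 0#

  idM : {m : ℕ} → Mat m
  idM = δ

  zeroM : {m : ℕ} → Mat m
  zeroM i j = 0#

  Tr : {m : ℕ} → Mat m → Carrier
  Tr {m} M = sumF m (λ i → M i i)

  block : {n : ℕ} → Mat n → Mat n → Mat n → Mat n → Mat (n ℕ.+ n)
  block {n} A B C D i j with Data.Fin.splitAt n i | Data.Fin.splitAt n j
  ... | Data.Sum.inj₁ i' | Data.Sum.inj₁ j' = A i' j'
  ... | Data.Sum.inj₁ i' | Data.Sum.inj₂ j' = B i' j'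
  ... | Data.Sum.inj₂ i' | Data.Sum.inj₁ j' = C i' j'
  ... | Data.Sum.inj₂ i' | Data.Sum.inj₂ j' = D i' j'

  -- the parabolic subgroup P⁺(2n,q): products
  --   diag(A , ᵗA⁻¹) · [[1 , B],[0 , 1]] = [[A , A B],[0 , ᵗA⁻¹]]
  -- with A ∈ GL(n,q), B symmetric with zero diagonal.
  -- (C is ᵗA⁻¹, i.e. C · ᵗA = 1, which also forces A invertible.)
  InP : (n : ℕ) → Mat (n ℕ.+ n) → Set
  InP n p = Σ (Mat n) λ A → Σ (Mat n) λ C → Σ (Mat n) λ B →
      ((C · transpose A) ≡ₘ idM)
    × (∀ i j → B i j ≡ B j i)
    × (∀ i → B i i ≡ 0#)
    × (p ≡ₘ (block A (A · B) zeroM C))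

  -- σ_s⁺ : swaps coordinates i and n+i for i < s (block form above)
  swapℕ : ℕ → ℕ → ℕ → ℕ
  swapℕ n s i with i ℕ.<? s | i ℕ.∸ n ℕ.<? s | n ℕ.≤? i
  ... | yes _ | _     | _     = i ℕ.+ n
  ... | no _  | yes _ | yes _ = i ℕ.∸ n
  ... | no _  | _     | _     = i

  σ : (n s : ℕ) → Mat (n ℕ.+ n)
  σ n s i j with toℕ j ℕ.≟ swapℕ n s (toℕ i)
  ... | yes _ = 1#
  ... | no  _ = 0#

  InDC : (n s : ℕ) → Mat (n ℕ.+ n) → Set
  InDC n s g = Σ (Mat (n ℕ.+ n)) λ p₁ → Σ (Mat (n ℕ.+ n)) λ p₂ →
    InP n p₁ × InP n p₂ × (g ≡ₘ ((p₁ · σ n s) · p₂))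

  Enumerates : (n s N : ℕ) → (Fin N → Mat (n ℕ.+ n)) → Set
  Enumerates n s N g =
      (∀ j → InDC n s (g j))
    × (∀ j k → g j ≡ₘ g k → j ≡ k)
    × (∀ h → InDC n s h → Σ (Fin N) λ j → g j ≡ₘ h)

  InCode : (n : ℕ) {N : ℕ} → (Fin N → Mat (n ℕ.+ n)) → (Fin N → Bool) → Set
  InCode n {N} g u = sumF N (λ j → ι (u j) * Tr (g j)) ≡ 0#

  dot : {N : ℕ} → (Fin N → Bool) → (Fin N → Bool) → Bool
  dot {zero} u v = false
  dot {suc N} u v = (u zero ∧ v zero) xor dot (λ j → u (suc j)) (λ j → v (suc j))

  InDual : (n : ℕ) {N : ℕ} → (Fin N → Mat (n ℕ.+ n)) → (Fin N → Bool) → Set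
  InDual n g v = ∀ u → InCode n g u → dot v u ≡ false

  cw : (n : ℕ) {N : ℕ} → (Fin N → Mat (n ℕ.+ n)) → Carrier → Fin N → Bool
  cw n g a j = bit (tr (a * Tr (g j)))

  LinIso : (n : ℕ) {N : ℕ} → (Fin N → Mat (n ℕ.+ n)) → Set
  LinIso n g =
      (∀ a → InDual n g (cw n g a))
    × (∀ a b j → cw n g (a + b) j ≡ (cw n g a j xor cw n g b j))
    × (∀ (e : Bool) a j → cw n g (ι e * a) j ≡ (e ∧ cw n g a j))
    × (∀ a b → (∀ j → cw n g a j ≡ cw n g b j) → a ≡ b)
    × (∀ v → InDual n g v → Σ Carrier λ a → ∀ j → cw n g a j ≡ v j)

  DCIso : (n s : ℕ) → Set
  DCIso n s = ∀ N (g : Fin N → Mat (n ℕ.+ n)) → Enumerates n s N g → LinIso n g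

Even Odd : ℕ → Set
Even n = Σ ℕ λ k → n ≡ 2 ℕ.* k
Odd n = Σ ℕ λ k → n ≡ suc (2 ℕ.* k)

{-# OPTIONS --safe #-}
-- The map a ↦ c(a) = (tr (a Tr gⱼ))ⱼ is F₂-linear and lands in C(D)^⊥, since the dot product of
-- c(a) with u is tr (a Σⱼ uⱼ Tr gⱼ). Delsarte's argument (induction on the length, using a trace
-- functional that separates a point from an F₂-span) shows that it is onto C(D)^⊥. It is
-- injective as soon as no c ≠ 0 has tr (c Tr g) = 0 for all g ∈ D. Explicit elements p σ_s of D
-- have as trace every x ∈ F_q (n ≥ 2, s ≥ 1), every x ≠ 1 (n = 2, s = 0), or every a + a⁻¹
-- (n = 1, s = 0). In each case nondegeneracy of the trace form, which rests on x^q = x and on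
-- the fact that a polynomial of degree < q vanishing on F_q is zero, then forces c = 0; the last
-- two cases need q ≥ 4 and q ≥ 8 respectively.
module Submission where

open import Defs
open import Data.Nat using (ℕ; _≤_; _∸_)
open import Data.Product using (_×_)
open import Data.Sum using (_⊎_)
open import Relation.Binary.PropositionalEquality using (_≡_)

open import Algebra.Bundles using (CommutativeRing)
import Algebra.Properties.CommutativeMonoid.Sum as CommutativeMonoidSum
import Algebra.Properties.CommutativeSemigroup as CommutativeSemigroupProperties
open import Data.Bool using (Bool; true; false; _∧_; _xor_)
import Data.Bool.Properties as BoolP
open import Data.Empty using (⊥-elim)
open import Data.Unit using (⊤; tt)
open import Data.Maybe using (nothing)
open import Data.Fin using (Fin; toℕ; fromℕ<; _↑ˡ_; _↑ʳ_; splitAt) renaming (zero to fz; suc to fs)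
import Data.Fin.Permutation as Permutation
import Data.Fin.Properties as FinP
import Data.Nat as ℕ
open import Data.Nat using (zero; suc; z≤n; s≤s; _<_; _^_)
import Data.Nat.Properties as ℕP
open import Data.Product using (Σ; ∃; _,_; proj₁; proj₂)
open import Data.Sum using (inj₁; inj₂)
open import Data.Vec using (lookup)
import Data.Vec.Relation.Unary.Any as Any
import Data.Vec.Relation.Unary.Any.Properties as AnyP
import Data.Vec.Relation.Unary.Unique.Propositional.Properties as UniqueP
open import Data.Vec.Functional using (_∷_)
open import Function using (_∘_)
open import Relation.Binary.PropositionalEquality using (refl; sym; trans; cong; cong₂; subst; _≢_; module ≡-Reasoning)
open import Relation.Binary.Definitions using (tri<; tri≈; tri>)
open import Relation.Nullary using (¬_; Dec; yes; no; ¬?; _×-dec_)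
open import Tactic.RingSolver.Core.AlmostCommutativeRing using (fromCommutativeRing)
import Tactic.RingSolver.NonReflective as RingSolver

module _ {r : ℕ} (F : FiniteField2 r) where
  open FF F renaming (_+_ to infixl 6 _+_; _*_ to infixl 7 _*_)

  commutativeRing : CommutativeRing _ _
  commutativeRing = record { isCommutativeRing = isCommutativeRing }

  open CommutativeRing commutativeRing
    using ( +-assoc; +-comm; +-identityˡ; +-identityʳ; *-assoc; *-comm; *-identityˡ; *-identityʳ
          ; distribˡ; distribʳ; zeroˡ; zeroʳ; +-commutativeSemigroup; *-commutativeSemigroup
          ; *-commutativeMonoid)
  open CommutativeSemigroupProperties +-commutativeSemigroup using () renaming (interchange to +-interchange)
  open CommutativeSemigroupProperties *-commutativeSemigroup using () renaming (interchange to *-interchange)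
  open RingSolver (fromCommutativeRing commutativeRing (λ _ → nothing)) using (solve; _⊜_; _⊕_; _⊗_)
  open ≡-Reasoning

  -- Characteristic two

  x+x≡0 : ∀ x → x + x ≡ 0#
  x+x≡0 x = begin
    x + x            ≡⟨ cong₂ _+_ (sym (*-identityʳ x)) (sym (*-identityʳ x)) ⟩
    x * 1# + x * 1#  ≡⟨ sym (distribˡ x 1# 1#) ⟩
    x * (1# + 1#)    ≡⟨ cong (x *_) char2 ⟩
    x * 0#           ≡⟨ zeroʳ x ⟩
    0#               ∎

  +-cancelˡ : ∀ a {b c} → a + b ≡ a + c → b ≡ c
  +-cancelˡ a {b} {c} a+b≡a+c = begin
    b            ≡⟨ sym (+-identityˡ b) ⟩
    0# + b       ≡⟨ cong (_+ b) (sym (x+x≡0 a)) ⟩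
    a + a + b    ≡⟨ +-assoc a a b ⟩
    a + (a + b)  ≡⟨ cong (a +_) a+b≡a+c ⟩
    a + (a + c)  ≡⟨ sym (+-assoc a a c) ⟩
    a + a + c    ≡⟨ cong (_+ c) (x+x≡0 a) ⟩
    0# + c       ≡⟨ +-identityˡ c ⟩
    c            ∎

  x+y≡0⇒x≡y : ∀ {x y} → x + y ≡ 0# → x ≡ y
  x+y≡0⇒x≡y {x} {y} x+y≡0 = +-cancelˡ y (trans (+-comm y x) (trans x+y≡0 (sym (x+x≡0 y))))

  x+[x+y]≡y : ∀ x y → x + (x + y) ≡ y
  x+[x+y]≡y x y = trans (sym (+-assoc x x y)) (trans (cong (_+ y) (x+x≡0 x)) (+-identityˡ y))

  [a+b]+[b+c]≡a+c : ∀ a b c → (a + b) + (b + c) ≡ a + c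
  [a+b]+[b+c]≡a+c a b c = begin
    (a + b) + (b + c)  ≡⟨ cong (_+ (b + c)) (+-comm a b) ⟩
    (b + a) + (b + c)  ≡⟨ +-interchange b a b c ⟩
    (b + b) + (a + c)  ≡⟨ cong (_+ (a + c)) (x+x≡0 b) ⟩
    0# + (a + c)       ≡⟨ +-identityˡ (a + c) ⟩
    a + c              ∎

  square-+ : ∀ x y → (x + y) * (x + y) ≡ x * x + y * y
  square-+ x y = begin
    (x + y) * (x + y)                  ≡⟨ distribʳ (x + y) x y ⟩
    x * (x + y) + y * (x + y)          ≡⟨ cong₂ _+_ (distribˡ x x y) (distribˡ y x y) ⟩
    (x * x + x * y) + (y * x + y * y)  ≡⟨ cong (λ z → (x * x + x * y) + (z + y * y)) (*-comm y x) ⟩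
    (x * x + x * y) + (x * y + y * y)  ≡⟨ [a+b]+[b+c]≡a+c _ _ _ ⟩
    x * x + y * y                      ∎

  1≢0 : 1# ≢ 0#
  1≢0 = 0≢1 ∘ sym

  _⁻¹ : ∀ x → {x ≢ 0#} → Carrier
  (x ⁻¹) {x≢0} = proj₁ (inverse x x≢0)

  x*x⁻¹≡1 : ∀ x (x≢0 : x ≢ 0#) → x * (x ⁻¹) {x≢0} ≡ 1#
  x*x⁻¹≡1 x x≢0 = proj₂ (inverse x x≢0)

  *-cancelˡ : ∀ a {b c} → a ≢ 0# → a * b ≡ a * c → b ≡ c
  *-cancelˡ a {b} {c} a≢0 ab≡ac = begin
    b                ≡⟨ sym (*-identityˡ b) ⟩
    1# * b           ≡⟨ cong (_* b) (sym a⁻¹a≡1) ⟩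
    a⁻¹ * a * b      ≡⟨ *-assoc a⁻¹ a b ⟩
    a⁻¹ * (a * b)    ≡⟨ cong (a⁻¹ *_) ab≡ac ⟩
    a⁻¹ * (a * c)    ≡⟨ sym (*-assoc a⁻¹ a c) ⟩
    a⁻¹ * a * c      ≡⟨ cong (_* c) a⁻¹a≡1 ⟩
    1# * c           ≡⟨ *-identityˡ c ⟩
    c                ∎
    where
      a⁻¹ : Carrier
      a⁻¹ = (a ⁻¹) {a≢0}
      a⁻¹a≡1 : a⁻¹ * a ≡ 1#
      a⁻¹a≡1 = trans (*-comm a⁻¹ a) (x*x⁻¹≡1 a a≢0)

  *-nonzero : ∀ {a b} → a ≢ 0# → b ≢ 0# → a * b ≢ 0#
  *-nonzero {a} a≢0 b≢0 ab≡0 = b≢0 (*-cancelˡ a a≢0 (trans ab≡0 (sym (zeroʳ a))))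

  x*x≡x⇒x≡0⊎x≡1 : ∀ {x} → x * x ≡ x → x ≡ 0# ⊎ x ≡ 1#
  x*x≡x⇒x≡0⊎x≡1 {x} xx≡x with x ≟ 0#
  ... | yes x≡0 = inj₁ x≡0
  ... | no x≢0 = inj₂ (*-cancelˡ x x≢0 (trans xx≡x (sym (*-identityʳ x))))

  -- Finite sums

  sumF-cong : ∀ N {f g : Fin N → Carrier} → (∀ i → f i ≡ g i) → sumF N f ≡ sumF N g
  sumF-cong zero    f≗g = refl
  sumF-cong (suc N) f≗g = cong₂ _+_ (f≗g fz) (sumF-cong N (f≗g ∘ fs))

  sumF-zero : ∀ N {f : Fin N → Carrier} → (∀ i → f i ≡ 0#) → sumF N f ≡ 0#
  sumF-zero zero    f≗0 = refl
  sumF-zero (suc N) f≗0 = trans (cong₂ _+_ (f≗0 fz) (sumF-zero N (f≗0 ∘ fs))) (+-identityˡ 0#)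

  sumF-distrib-+ : ∀ N (f g : Fin N → Carrier) → sumF N (λ i → f i + g i) ≡ sumF N f + sumF N g
  sumF-distrib-+ zero    f g = sym (+-identityˡ 0#)
  sumF-distrib-+ (suc N) f g =
    trans (cong (f fz + g fz +_) (sumF-distrib-+ N (f ∘ fs) (g ∘ fs))) (+-interchange _ _ _ _)

  *-distribˡ-sumF : ∀ N c (f : Fin N → Carrier) → c * sumF N f ≡ sumF N (λ i → c * f i)
  *-distribˡ-sumF zero    c f = zeroʳ c
  *-distribˡ-sumF (suc N) c f = trans (distribˡ c _ _) (cong (c * f fz +_) (*-distribˡ-sumF N c (f ∘ fs)))

  *-distribʳ-sumF : ∀ N c (f : Fin N → Carrier) → sumF N f * c ≡ sumF N (λ i → f i * c)
  *-distribʳ-sumF N c f =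
    trans (*-comm _ c) (trans (*-distribˡ-sumF N c f) (sumF-cong N (λ i → *-comm c (f i))))

  sumF-single : ∀ N (f : Fin N → Carrier) k → (∀ i → i ≢ k → f i ≡ 0#) → sumF N f ≡ f k
  sumF-single (suc N) f fz     f≗0 = trans (cong (f fz +_) (sumF-zero N (λ i → f≗0 (fs i) λ ()))) (+-identityʳ _)
  sumF-single (suc N) f (fs k) f≗0 = trans (cong₂ _+_ (f≗0 fz λ ()) (sumF-single N (f ∘ fs) k f∘fs≗0)) (+-identityˡ _)
    where
      f∘fs≗0 : ∀ i → i ≢ k → f (fs i) ≡ 0#
      f∘fs≗0 i i≢k = f≗0 (fs i) (i≢k ∘ FinP.suc-injective)

  sumF-splitAt : ∀ m n (f : Fin (m ℕ.+ n) → Carrier) →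
    sumF (m ℕ.+ n) f ≡ sumF m (λ i → f (i ↑ˡ n)) + sumF n (λ i → f (m ↑ʳ i))
  sumF-splitAt zero    n f = sym (+-identityˡ _)
  sumF-splitAt (suc m) n f = trans (cong (f fz +_) (sumF-splitAt m n (f ∘ fs))) (sym (+-assoc _ _ _))

  sumF-comm : ∀ m n (f : Fin m → Fin n → Carrier) →
    sumF m (λ i → sumF n (f i)) ≡ sumF n (λ j → sumF m (λ i → f i j))
  sumF-comm zero    n f = sym (sumF-zero n (λ _ → refl))
  sumF-comm (suc m) n f = begin
    sumF n (f fz) + sumF m (λ i → sumF n (f (fs i)))          ≡⟨ cong (sumF n (f fz) +_) (sumF-comm m n (f ∘ fs)) ⟩
    sumF n (f fz) + sumF n (λ j → sumF m (λ i → f (fs i) j))  ≡⟨ sym (sumF-distrib-+ n _ _) ⟩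
    sumF n (λ j → sumF (suc m) (λ i → f i j))                 ∎

  sumF-square : ∀ N (f : Fin N → Carrier) → sumF N f * sumF N f ≡ sumF N (λ i → f i * f i)
  sumF-square zero    f = zeroˡ 0#
  sumF-square (suc N) f = trans (square-+ _ _) (cong (f fz * f fz +_) (sumF-square N (f ∘ fs)))

  sumF-shift : ∀ N (g : ℕ → Carrier) →
    g 0 + sumF N (λ i → g (suc (toℕ i))) ≡ sumF N (λ i → g (toℕ i)) + g N
  sumF-shift zero    g = trans (+-identityʳ _) (sym (+-identityˡ _))
  sumF-shift (suc N) g = begin
    g 0 + (g 1 + sumF N (λ i → g (suc (suc (toℕ i)))))  ≡⟨ cong (g 0 +_) (sumF-shift N (g ∘ suc)) ⟩
    g 0 + (sumF N (λ i → g (suc (toℕ i))) + g (suc N))  ≡⟨ sym (+-assoc _ _ _) ⟩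
    g 0 + sumF N (λ i → g (suc (toℕ i))) + g (suc N)    ∎

  -- Frobenius, the absolute trace and Fermat's little theorem

  pow-+ : ∀ x m n → pow x (m ℕ.+ n) ≡ pow x m * pow x n
  pow-+ x zero    n = sym (*-identityˡ _)
  pow-+ x (suc m) n = trans (cong (x *_) (pow-+ x m n)) (sym (*-assoc _ _ _))

  pow-distrib-* : ∀ x y n → pow (x * y) n ≡ pow x n * pow y n
  pow-distrib-* x y zero    = sym (*-identityˡ 1#)
  pow-distrib-* x y (suc n) = trans (cong (x * y *_) (pow-distrib-* x y n)) (*-interchange x y _ _)

  pow-1# : ∀ n → pow 1# n ≡ 1#
  pow-1# zero    = refl
  pow-1# (suc n) = trans (*-identityˡ _) (pow-1# n)

  pow-0# : ∀ {n} → 0 < n → pow 0# n ≡ 0#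
  pow-0# {suc n} _ = zeroˡ _

  pow-nonzero : ∀ {x} n → x ≢ 0# → pow x n ≢ 0#
  pow-nonzero zero    x≢0 = 1≢0
  pow-nonzero (suc n) x≢0 = *-nonzero x≢0 (pow-nonzero n x≢0)

  pow-2^suc : ∀ x i → pow x (2 ^ suc i) ≡ pow x (2 ^ i) * pow x (2 ^ i)
  pow-2^suc x i = trans (cong (pow x) (cong (2 ^ i ℕ.+_) (ℕP.+-identityʳ (2 ^ i)))) (pow-+ x (2 ^ i) (2 ^ i))

  frobenius : ∀ x y i → pow (x + y) (2 ^ i) ≡ pow x (2 ^ i) + pow y (2 ^ i)
  frobenius x y zero    = trans (*-identityʳ _) (cong₂ _+_ (sym (*-identityʳ x)) (sym (*-identityʳ y)))
  frobenius x y (suc i) = begin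
    pow (x + y) (2 ^ suc i)                      ≡⟨ pow-2^suc (x + y) i ⟩
    pow (x + y) (2 ^ i) * pow (x + y) (2 ^ i)    ≡⟨ cong₂ _*_ (frobenius x y i) (frobenius x y i) ⟩
    (X + Y) * (X + Y)                            ≡⟨ square-+ X Y ⟩
    X * X + Y * Y                                ≡⟨ sym (cong₂ _+_ (pow-2^suc x i) (pow-2^suc y i)) ⟩
    pow x (2 ^ suc i) + pow y (2 ^ suc i)        ∎
    where
      X Y : Carrier
      X = pow x (2 ^ i)
      Y = pow y (2 ^ i)

  tr-+ : ∀ x y → tr (x + y) ≡ tr x + tr y
  tr-+ x y = trans (sumF-cong r (λ i → frobenius x y (toℕ i))) (sumF-distrib-+ r _ _)

  q : ℕ
  q = 2 ^ r

  0<q : 0 < q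
  0<q = ℕP.m^n>0 2 r

  x+tr²≡tr+x^q : ∀ x → x + tr x * tr x ≡ tr x + pow x q
  x+tr²≡tr+x^q x = begin
    x + tr x * tr x                          ≡⟨ cong₂ _+_ (sym (*-identityʳ x)) (sumF-square r _) ⟩
    g 0 + sumF r (λ i → g′ i * g′ i)         ≡⟨ cong (g 0 +_) (sumF-cong r (λ i → sym (pow-2^suc x (toℕ i)))) ⟩
    g 0 + sumF r (λ i → g (suc (toℕ i)))     ≡⟨ sumF-shift r g ⟩
    tr x + pow x q                           ∎
    where
      g : ℕ → Carrier
      g k = pow x (2 ^ k)
      g′ : Fin r → Carrier
      g′ i = g (toℕ i)

  element : Fin q → Carrier
  element = lookup elements

  index : Carrier → Fin q
  index x = Any.index (elements-complete x)

  element-index : ∀ x → element (index x) ≡ x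
  element-index x = sym (AnyP.lookup-index (elements-complete x))

  element-injective : ∀ {i j} → element i ≡ element j → i ≡ j
  element-injective = UniqueP.lookup-injective elements-unique _ _

  open CommutativeMonoidSum *-commutativeMonoid using ()
    renaming (sum to ∏; sum-cong-≗ to ∏-cong; sum-permute to ∏-permute)

  ∏-invariant : (f f⁻¹ : Carrier → Carrier) → (∀ y → f (f⁻¹ y) ≡ y) → (∀ y → f⁻¹ (f y) ≡ y) →
    (h : Carrier → Carrier) → ∏ (h ∘ element) ≡ ∏ (h ∘ f ∘ element)
  ∏-invariant f f⁻¹ inverseˡ inverseʳ h =
    trans (∏-permute (h ∘ element) π) (∏-cong (λ i → cong h (element-index (f (element i)))))
    where
      π : Permutation.Permutation q q
      π = Permutation.permutation (index ∘ f ∘ element) (index ∘ f⁻¹ ∘ element)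
            (λ i → element-injective (begin
              element (index (f (element (index (f⁻¹ (element i))))))  ≡⟨ element-index _ ⟩
              f (element (index (f⁻¹ (element i))))                    ≡⟨ cong f (element-index _) ⟩
              f (f⁻¹ (element i))                                      ≡⟨ inverseˡ (element i) ⟩
              element i                                                ∎))
            (λ i → element-injective (begin
              element (index (f⁻¹ (element (index (f (element i))))))  ≡⟨ element-index _ ⟩
              f⁻¹ (element (index (f (element i))))                    ≡⟨ cong f⁻¹ (element-index _) ⟩
              f⁻¹ (f (element i))                                      ≡⟨ inverseʳ (element i) ⟩
              element i                                                ∎))

  ∏-swapAt : ∀ N (f g : Fin N → Carrier) k → (∀ i → i ≢ k → f i ≡ g i) → ∏ f * g k ≡ ∏ g * f k
  ∏-swapAt (suc N) f g fz f≗g = begin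
    f fz * ∏ (f ∘ fs) * g fz  ≡⟨ cong (λ p → f fz * p * g fz) (∏-cong (λ i → f≗g (fs i) λ ())) ⟩
    f fz * ∏ (g ∘ fs) * g fz  ≡⟨ *-comm _ (g fz) ⟩
    g fz * (f fz * ∏ (g ∘ fs)) ≡⟨ cong (g fz *_) (*-comm (f fz) _) ⟩
    g fz * (∏ (g ∘ fs) * f fz) ≡⟨ sym (*-assoc _ _ _) ⟩
    g fz * ∏ (g ∘ fs) * f fz  ∎
  ∏-swapAt (suc N) f g (fs k) f≗g = begin
    f fz * ∏ (f ∘ fs) * g (fs k)    ≡⟨ *-assoc _ _ _ ⟩
    f fz * (∏ (f ∘ fs) * g (fs k))  ≡⟨ cong₂ _*_ (f≗g fz λ ()) (∏-swapAt N (f ∘ fs) (g ∘ fs) k λ i i≢k → f≗g (fs i) (i≢k ∘ FinP.suc-injective)) ⟩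
    g fz * (∏ (g ∘ fs) * f (fs k))  ≡⟨ sym (*-assoc _ _ _) ⟩
    g fz * ∏ (g ∘ fs) * f (fs k)    ∎

  ∏-scale : ∀ N c (f : Fin N → Carrier) → ∏ (λ i → c * f i) ≡ pow c N * ∏ f
  ∏-scale zero    c f = sym (*-identityˡ 1#)
  ∏-scale (suc N) c f = trans (cong (c * f fz *_) (∏-scale N c (f ∘ fs))) (*-interchange c (f fz) _ _)

  ∏-nonzero : ∀ N (f : Fin N → Carrier) → (∀ i → f i ≢ 0#) → ∏ f ≢ 0#
  ∏-nonzero zero    f f≢0 = 1≢0
  ∏-nonzero (suc N) f f≢0 = *-nonzero (f≢0 fz) (∏-nonzero N (f ∘ fs) (f≢0 ∘ fs))

  orOne : Carrier → Carrier
  orOne y with y ≟ 0#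
  ... | yes _ = 1#
  ... | no _  = y

  orOne-nonzero : ∀ y → orOne y ≢ 0#
  orOne-nonzero y with y ≟ 0#
  ... | yes _   = 1≢0
  ... | no y≢0  = y≢0

  orOne-0# : orOne 0# ≡ 1#
  orOne-0# with 0# ≟ 0#
  ... | yes _ = refl
  ... | no 0≢0 = ⊥-elim (0≢0 refl)

  orOne-≢0 : ∀ {y} → y ≢ 0# → orOne y ≡ y
  orOne-≢0 {y} y≢0 with y ≟ 0#
  ... | yes y≡0 = ⊥-elim (y≢0 y≡0)
  ... | no _    = refl

  -- y ↦ x y permutes F_q, so ∏ orOne (x y) = ∏ orOne y; the left side agrees termwise with
  -- ∏ x orOne y = x^q ∏ orOne y except at y = 0, where the factors are 1 and x.
  fermat-nonzero : ∀ {x} → x ≢ 0# → pow x q ≡ x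
  fermat-nonzero {x} x≢0 = sym (*-cancelˡ P P≢0 (begin
    P * x             ≡⟨ cong₂ _*_ P≡∏f (sym gk≡x) ⟩
    ∏ f * g k         ≡⟨ ∏-swapAt q f g k f≗g ⟩
    ∏ g * f k         ≡⟨ cong₂ _*_ (∏-scale q x (orOne ∘ element)) fk≡1 ⟩
    pow x q * P * 1#  ≡⟨ *-identityʳ _ ⟩
    pow x q * P       ≡⟨ *-comm _ P ⟩
    P * pow x q       ∎))
    where
      x⁻¹ P : Carrier
      x⁻¹ = (x ⁻¹) {x≢0}
      P = ∏ (orOne ∘ element)
      f g : Fin q → Carrier
      f i = orOne (x * element i)
      g i = x * orOne (element i)
      k : Fin q
      k = index 0#
      P≢0 : P ≢ 0#
      P≢0 = ∏-nonzero q _ (orOne-nonzero ∘ element)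
      P≡∏f : P ≡ ∏ f
      P≡∏f = ∏-invariant (x *_) (x⁻¹ *_)
        (λ y → trans (sym (*-assoc x x⁻¹ y)) (trans (cong (_* y) (x*x⁻¹≡1 x x≢0)) (*-identityˡ y)))
        (λ y → trans (sym (*-assoc x⁻¹ x y)) (trans (cong (_* y) (trans (*-comm x⁻¹ x) (x*x⁻¹≡1 x x≢0))) (*-identityˡ y)))
        orOne
      gk≡x : g k ≡ x
      gk≡x = trans (cong (λ y → x * orOne y) (element-index 0#)) (trans (cong (x *_) orOne-0#) (*-identityʳ x))
      fk≡1 : f k ≡ 1#
      fk≡1 = trans (cong (λ y → orOne (x * y)) (element-index 0#)) (trans (cong orOne (zeroʳ x)) orOne-0#)
      f≗g : ∀ i → i ≢ k → f i ≡ g i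
      f≗g i i≢k = trans (orOne-≢0 (*-nonzero x≢0 eᵢ≢0)) (cong (x *_) (sym (orOne-≢0 eᵢ≢0)))
        where
          eᵢ≢0 : element i ≢ 0#
          eᵢ≢0 eᵢ≡0 = i≢k (element-injective (trans eᵢ≡0 (sym (element-index 0#))))

  fermat : ∀ x → pow x q ≡ x
  fermat x with x ≟ 0#
  ... | yes refl = pow-0# 0<q
  ... | no x≢0   = fermat-nonzero x≢0

  pow-q∸k : ∀ {y} (y≢0 : y ≢ 0#) k → k ≤ q → pow y (q ∸ k) ≡ pow ((y ⁻¹) {y≢0}) k * y
  pow-q∸k {y} y≢0 k k≤q = *-cancelˡ (pow y k) (pow-nonzero k y≢0) (begin
    pow y k * pow y (q ∸ k)       ≡⟨ sym (pow-+ y k (q ∸ k)) ⟩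
    pow y (k ℕ.+ (q ∸ k))         ≡⟨ cong (pow y) (ℕP.m+[n∸m]≡n k≤q) ⟩
    pow y q                       ≡⟨ fermat y ⟩
    y                             ≡⟨ sym (*-identityˡ y) ⟩
    1# * y                        ≡⟨ cong (_* y) (sym (pow-1# k)) ⟩
    pow 1# k * y                  ≡⟨ cong (λ z → pow z k * y) (sym (x*x⁻¹≡1 y y≢0)) ⟩
    pow (y * y⁻¹) k * y           ≡⟨ cong (_* y) (pow-distrib-* y y⁻¹ k) ⟩
    pow y k * pow y⁻¹ k * y       ≡⟨ *-assoc _ _ _ ⟩
    pow y k * (pow y⁻¹ k * y)     ∎)
    where
      y⁻¹ : Carrier
      y⁻¹ = (y ⁻¹) {y≢0}

  tr∈F₂ : ∀ x → tr x ≡ 0# ⊎ tr x ≡ 1#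
  tr∈F₂ x = x*x≡x⇒x≡0⊎x≡1 (+-cancelˡ x (begin
    x + tr x * tr x   ≡⟨ x+tr²≡tr+x^q x ⟩
    tr x + pow x q    ≡⟨ cong (tr x +_) (fermat x) ⟩
    tr x + x          ≡⟨ +-comm (tr x) x ⟩
    x + tr x          ∎))

  -- The F₂-valued trace form

  xor≡false⇒≡ : ∀ {a b} → a xor b ≡ false → a ≡ b
  xor≡false⇒≡ {true}  {true}  _ = refl
  xor≡false⇒≡ {false} {false} _ = refl

  ≢⇒xor-true≡ : ∀ {a b} → a ≢ b → a xor true ≡ b
  ≢⇒xor-true≡ {true}  {false} _   = refl
  ≢⇒xor-true≡ {false} {true}  _   = refl
  ≢⇒xor-true≡ {true}  {true}  a≢b = ⊥-elim (a≢b refl)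
  ≢⇒xor-true≡ {false} {false} a≢b = ⊥-elim (a≢b refl)

  bit-ι : ∀ b → bit (ι b) ≡ b
  bit-ι true with 1# ≟ 0#
  ... | yes 1≡0 = ⊥-elim (1≢0 1≡0)
  ... | no _    = refl
  bit-ι false with 0# ≟ 0#
  ... | yes _   = refl
  ... | no 0≢0  = ⊥-elim (0≢0 refl)

  ι-bit : ∀ {t} → t ≡ 0# ⊎ t ≡ 1# → ι (bit t) ≡ t
  ι-bit (inj₁ refl) = cong ι (bit-ι false)
  ι-bit (inj₂ refl) = cong ι (bit-ι true)

  ι-xor : ∀ a b → ι (a xor b) ≡ ι a + ι b
  ι-xor true  true  = sym (x+x≡0 1#)
  ι-xor true  false = sym (+-identityʳ 1#)
  ι-xor false b     = sym (+-identityˡ (ι b))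

  bit-+ : ∀ {t u} → t ≡ 0# ⊎ t ≡ 1# → u ≡ 0# ⊎ u ≡ 1# → bit (t + u) ≡ bit t xor bit u
  bit-+ {t} {u} t∈F₂ u∈F₂ = begin
    bit (t + u)                    ≡⟨ cong bit (sym (cong₂ _+_ (ι-bit t∈F₂) (ι-bit u∈F₂))) ⟩
    bit (ι (bit t) + ι (bit u))    ≡⟨ cong bit (sym (ι-xor (bit t) (bit u))) ⟩
    bit (ι (bit t xor bit u))      ≡⟨ bit-ι _ ⟩
    bit t xor bit u                ∎

  tr-0# : tr 0# ≡ 0#
  tr-0# = sumF-zero r (λ i → pow-0# (ℕP.m^n>0 2 (toℕ i)))

  -- cw n g a j is definitionally ⟪ a , Tr (g j) ⟫.
  ⟪_,_⟫ : Carrier → Carrier → Bool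
  ⟪ a , y ⟫ = bit (tr (a * y))

  ι⟪⟫ : ∀ a y → ι ⟪ a , y ⟫ ≡ tr (a * y)
  ι⟪⟫ a y = ι-bit (tr∈F₂ (a * y))

  ⟪⟫-comm : ∀ a y → ⟪ a , y ⟫ ≡ ⟪ y , a ⟫
  ⟪⟫-comm a y = cong (bit ∘ tr) (*-comm a y)

  ⟪⟫-distribˡ : ∀ a b y → ⟪ a + b , y ⟫ ≡ ⟪ a , y ⟫ xor ⟪ b , y ⟫
  ⟪⟫-distribˡ a b y =
    trans (cong bit (trans (cong tr (distribʳ y a b)) (tr-+ _ _))) (bit-+ (tr∈F₂ _) (tr∈F₂ _))

  ⟪⟫-distribʳ : ∀ a y z → ⟪ a , y + z ⟫ ≡ ⟪ a , y ⟫ xor ⟪ a , z ⟫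
  ⟪⟫-distribʳ a y z =
    trans (cong bit (trans (cong tr (distribˡ a y z)) (tr-+ _ _))) (bit-+ (tr∈F₂ _) (tr∈F₂ _))

  ⟪⟫-zeroʳ : ∀ a → ⟪ a , 0# ⟫ ≡ false
  ⟪⟫-zeroʳ a = trans (cong (bit ∘ tr) (zeroʳ a)) (trans (cong bit tr-0#) (bit-ι false))

  ⟪⟫-ι*ˡ : ∀ e a y → ⟪ ι e * a , y ⟫ ≡ e ∧ ⟪ a , y ⟫
  ⟪⟫-ι*ˡ true  a y = cong (λ b → ⟪ b , y ⟫) (*-identityˡ a)
  ⟪⟫-ι*ˡ false a y = trans (cong (λ b → ⟪ b , y ⟫) (zeroˡ a)) (trans (⟪⟫-comm 0# y) (⟪⟫-zeroʳ y))

  ⟪⟫-ι*ʳ : ∀ a e y → ⟪ a , ι e * y ⟫ ≡ ⟪ a , y ⟫ ∧ e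
  ⟪⟫-ι*ʳ a e y = begin
    ⟪ a , ι e * y ⟫   ≡⟨ ⟪⟫-comm a _ ⟩
    ⟪ ι e * y , a ⟫   ≡⟨ ⟪⟫-ι*ˡ e y a ⟩
    e ∧ ⟪ y , a ⟫     ≡⟨ BoolP.∧-comm e _ ⟩
    ⟪ y , a ⟫ ∧ e     ≡⟨ cong (_∧ e) (⟪⟫-comm y a) ⟩
    ⟪ a , y ⟫ ∧ e     ∎

  -- Polynomials of degree less than q

  horner : ∀ {n} → (Fin n → Carrier) → Carrier → Carrier
  horner {zero}  c x = 0#
  horner {suc n} c x = c fz + x * horner (c ∘ fs) x

  -- The coefficients of (horner c y - horner c x) / (y - x).
  quotient : ∀ {n} → (Fin (suc n) → Carrier) → Carrier → Fin n → Carrier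
  quotient {zero}  c x = λ ()
  quotient {suc n} c x = horner (c ∘ fs) x ∷ quotient (c ∘ fs) x

  horner-quotient : ∀ {n} (c : Fin (suc n) → Carrier) x y →
    horner c y ≡ horner c x + (y + x) * horner (quotient c x) y
  horner-quotient {zero} c x y =
    trans (cong (c fz +_) (zeroʳ y)) (sym (trans (cong₂ _+_ (cong (c fz +_) (zeroʳ x)) (zeroʳ _)) (+-identityʳ _)))
  horner-quotient {suc n} c x y = begin
    c₀ + y * E y                                       ≡⟨ cong (λ z → c₀ + y * z) (horner-quotient (c ∘ fs) x y) ⟩
    c₀ + y * (E x + (y + x) * Q)                       ≡⟨ sym (+-identityʳ _) ⟩
    c₀ + y * (E x + (y + x) * Q) + 0#                  ≡⟨ cong (c₀ + y * (E x + (y + x) * Q) +_) (sym (x+x≡0 (x * E x))) ⟩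
    c₀ + y * (E x + (y + x) * Q) + (x * E x + x * E x) ≡⟨ regroup c₀ y x (E x) Q ⟩
    c₀ + x * E x + (y + x) * (E x + y * Q)             ∎
    where
      c₀ Q : Carrier
      c₀ = c fz
      Q = horner (quotient (c ∘ fs) x) y
      E : Carrier → Carrier
      E = horner (c ∘ fs)
      regroup : ∀ c y x e Q →
        c + y * (e + (y + x) * Q) + (x * e + x * e) ≡ c + x * e + (y + x) * (e + y * Q)
      regroup = solve 5 (λ c y x e Q →
        ((c ⊕ (y ⊗ (e ⊕ ((y ⊕ x) ⊗ Q)))) ⊕ ((x ⊗ e) ⊕ (x ⊗ e))) ⊜ ((c ⊕ (x ⊗ e)) ⊕ ((y ⊕ x) ⊗ (e ⊕ (y ⊗ Q))))) refl

  quotient-zero : ∀ {n} (c : Fin (suc n) → Carrier) x →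
    (∀ i → quotient c x i ≡ 0#) → horner c x ≡ 0# → ∀ i → c i ≡ 0#
  quotient-zero {zero}  c x _ c[x]≡0 fz = trans (sym (trans (cong (c fz +_) (zeroʳ x)) (+-identityʳ _))) c[x]≡0
  quotient-zero {suc n} c x Q≡0 c[x]≡0 fz =
    trans (sym (trans (cong (λ z → c fz + x * z) (Q≡0 fz)) (trans (cong (c fz +_) (zeroʳ x)) (+-identityʳ _)))) c[x]≡0
  quotient-zero {suc n} c x Q≡0 c[x]≡0 (fs i) = quotient-zero (c ∘ fs) x (Q≡0 ∘ fs) (Q≡0 fz) i

  horner-roots : ∀ {n k} (c : Fin n → Carrier) (p : Fin k → Carrier) → (∀ {i j} → p i ≡ p j → i ≡ j) →
    n ≤ k → (∀ i → horner c (p i) ≡ 0#) → ∀ i → c i ≡ 0#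
  horner-roots {suc n} {suc k} c p p-injective (s≤s n≤k) roots =
    quotient-zero c x (horner-roots Q (p ∘ fs) (FinP.suc-injective ∘ p-injective) n≤k Q-roots) (roots fz)
    where
      x : Carrier
      x = p fz
      Q : Fin n → Carrier
      Q = quotient c x
      Q-roots : ∀ i → horner Q (p (fs i)) ≡ 0#
      Q-roots i = *-cancelˡ (y + x) y+x≢0 (begin
        (y + x) * horner Q y                 ≡⟨ sym (+-identityˡ _) ⟩
        0# + (y + x) * horner Q y            ≡⟨ cong (_+ (y + x) * horner Q y) (sym (roots fz)) ⟩
        horner c x + (y + x) * horner Q y    ≡⟨ sym (horner-quotient c x y) ⟩
        horner c y                           ≡⟨ roots (fs i) ⟩
        0#                                   ≡⟨ sym (zeroʳ _) ⟩
        (y + x) * 0#                         ∎)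
        where
          y : Carrier
          y = p (fs i)
          y+x≢0 : y + x ≢ 0#
          y+x≢0 y+x≡0 with p-injective (x+y≡0⇒x≡y y+x≡0)
          ... | ()

  horner≡powerSum : ∀ {n} (c : Fin n → Carrier) x → horner c x ≡ sumF n (λ i → c i * pow x (toℕ i))
  horner≡powerSum {zero}  c x = refl
  horner≡powerSum {suc n} c x = cong₂ _+_ (sym (*-identityʳ (c fz))) (begin
    x * horner (c ∘ fs) x                                ≡⟨ cong (x *_) (horner≡powerSum (c ∘ fs) x) ⟩
    x * sumF n (λ i → c (fs i) * pow x (toℕ i))         ≡⟨ *-distribˡ-sumF n x _ ⟩
    sumF n (λ i → x * (c (fs i) * pow x (toℕ i)))       ≡⟨ sumF-cong n (λ i → x∙yz≈y∙xz x (c (fs i)) _) ⟩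
    sumF n (λ i → c (fs i) * pow x (suc (toℕ i)))       ∎)
    where open CommutativeSemigroupProperties *-commutativeSemigroup using (x∙yz≈y∙xz)

  powerSum-vanishing : (f : ℕ → Carrier) → (∀ y → sumF q (λ i → f (toℕ i) * pow y (toℕ i)) ≡ 0#) →
    ∀ {k} → k < q → f k ≡ 0#
  powerSum-vanishing f vanishes k<q =
    trans (cong f (sym (FinP.toℕ-fromℕ< k<q)))
      (horner-roots {q} (f ∘ toℕ) element element-injective ℕP.≤-refl
        (λ i → trans (horner≡powerSum {q} (f ∘ toℕ) (element i)) (vanishes (element i))) (fromℕ< k<q))

  δℕ : ℕ → ℕ → Carrier
  δℕ m n with m ℕ.≟ n
  ... | yes _ = 1#
  ... | no _  = 0#

  δℕ-refl : ∀ n → δℕ n n ≡ 1#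
  δℕ-refl n with n ℕ.≟ n
  ... | yes _   = refl
  ... | no n≢n  = ⊥-elim (n≢n refl)

  δℕ-≢ : ∀ {m n} → m ≢ n → δℕ m n ≡ 0#
  δℕ-≢ {m} {n} m≢n with m ℕ.≟ n
  ... | yes m≡n = ⊥-elim (m≢n m≡n)
  ... | no _    = refl

  coefficient : ∀ {T} → (Fin T → Carrier) → (Fin T → ℕ) → ℕ → Carrier
  coefficient {T} c e k = sumF T (λ t → δℕ (e t) k * c t)

  sparse≡powerSum : ∀ n {T} (c : Fin T → Carrier) (e : Fin T → ℕ) → (∀ t → e t < n) → ∀ y →
    sumF n (λ i → coefficient c e (toℕ i) * pow y (toℕ i)) ≡ sumF T (λ t → c t * pow y (e t))
  sparse≡powerSum n {T} c e e<n y = begin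
    sumF n (λ i → coefficient c e (toℕ i) * pow y (toℕ i))          ≡⟨ sumF-cong n (λ i → *-distribʳ-sumF T _ _) ⟩
    sumF n (λ i → sumF T (λ t → monomialAt t (toℕ i)))             ≡⟨ sumF-comm n T _ ⟩
    sumF T (λ t → sumF n (λ i → monomialAt t (toℕ i)))             ≡⟨ sumF-cong T monomial ⟩
    sumF T (λ t → c t * pow y (e t))                                ∎
    where
      monomialAt : Fin T → ℕ → Carrier
      monomialAt t k = δℕ (e t) k * c t * pow y k
      monomial : ∀ t → sumF n (λ i → monomialAt t (toℕ i)) ≡ c t * pow y (e t)
      monomial t = begin
        sumF n (λ i → monomialAt t (toℕ i))   ≡⟨ sumF-single n _ (fromℕ< (e<n t)) off ⟩
        monomialAt t (toℕ (fromℕ< (e<n t)))   ≡⟨ cong (monomialAt t) (FinP.toℕ-fromℕ< (e<n t)) ⟩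
        δℕ (e t) (e t) * c t * pow y (e t)    ≡⟨ cong (λ d → d * c t * pow y (e t)) (δℕ-refl (e t)) ⟩
        1# * c t * pow y (e t)                ≡⟨ cong (_* pow y (e t)) (*-identityˡ (c t)) ⟩
        c t * pow y (e t)                     ∎
        where
          off : ∀ i → i ≢ fromℕ< (e<n t) → monomialAt t (toℕ i) ≡ 0#
          off i i≢ = begin
            δℕ (e t) (toℕ i) * c t * pow y (toℕ i)  ≡⟨ cong (λ d → d * c t * pow y (toℕ i)) (δℕ-≢ eₜ≢i) ⟩
            0# * c t * pow y (toℕ i)                ≡⟨ cong (_* pow y (toℕ i)) (zeroˡ (c t)) ⟩
            0# * pow y (toℕ i)                      ≡⟨ zeroˡ _ ⟩
            0#                                      ∎
            where
              eₜ≢i : e t ≢ toℕ i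
              eₜ≢i eₜ≡i = i≢ (FinP.toℕ-injective (trans (sym eₜ≡i) (sym (FinP.toℕ-fromℕ< (e<n t)))))

  -- Nondegeneracy of the trace form

  2≤q : 2 ≤ q
  2≤q = FinP.injective⇒≤ {f = index-0#-1#} index-0#-1#-injective
    where
      index-0#-1# : Fin 2 → Fin q
      index-0#-1# fz     = index 0#
      index-0#-1# (fs _) = index 1#
      index0≢index1 : index 0# ≢ index 1#
      index0≢index1 eq = 0≢1 (trans (sym (element-index 0#)) (trans (cong element eq) (element-index 1#)))
      index-0#-1#-injective : ∀ {i j} → index-0#-1# i ≡ index-0#-1# j → i ≡ j
      index-0#-1#-injective {fz}    {fz}    _  = refl
      index-0#-1#-injective {fz}    {fs fz} eq = ⊥-elim (index0≢index1 eq)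
      index-0#-1#-injective {fs fz} {fz}    eq = ⊥-elim (index0≢index1 (sym eq))
      index-0#-1#-injective {fs fz} {fs fz} _  = refl

  0<r : 0 < r
  0<r = 2≤2^n⇒0<n r 2≤q
    where
      2≤2^n⇒0<n : ∀ n → 2 ≤ 2 ^ n → 0 < n
      2≤2^n⇒0<n zero    (s≤s ())
      2≤2^n⇒0<n (suc n) _ = s≤s z≤n

  2^-injective : ∀ {m n} → 2 ^ m ≡ 2 ^ n → m ≡ n
  2^-injective {m} {n} 2^m≡2^n with ℕP.<-cmp m n
  ... | tri< m<n _ _ = ⊥-elim (ℕP.<⇒≢ (ℕP.^-monoʳ-< 2 (s≤s (s≤s z≤n)) m<n) 2^m≡2^n)
  ... | tri≈ _ m≡n _ = m≡n
  ... | tri> _ _ n<m = ⊥-elim (ℕP.<⇒≢ (ℕP.^-monoʳ-< 2 (s≤s (s≤s z≤n)) n<m) (sym 2^m≡2^n))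

  coefficient-at : ∀ {T} (c : Fin T → Carrier) (e : Fin T → ℕ) → (∀ {t u} → e t ≡ e u → t ≡ u) →
    ∀ t₀ → coefficient c e (e t₀) ≡ c t₀
  coefficient-at {T} c e e-injective t₀ = begin
    sumF T (λ t → δℕ (e t) (e t₀) * c t)  ≡⟨ sumF-single T _ t₀ other ⟩
    δℕ (e t₀) (e t₀) * c t₀               ≡⟨ cong (_* c t₀) (δℕ-refl (e t₀)) ⟩
    1# * c t₀                             ≡⟨ *-identityˡ (c t₀) ⟩
    c t₀                                  ∎
    where
      other : ∀ t → t ≢ t₀ → δℕ (e t) (e t₀) * c t ≡ 0#
      other t t≢t₀ = trans (cong (_* c t) (δℕ-≢ (t≢t₀ ∘ e-injective))) (zeroˡ (c t))

  2^t<q : ∀ (t : Fin r) → 2 ^ toℕ t < q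
  2^t<q t = ℕP.^-monoʳ-< 2 (s≤s (s≤s z≤n)) (FinP.toℕ<n t)

  tr-nonvanishing : ¬ (∀ y → tr y ≡ 0#)
  tr-nonvanishing tr≡0 =
    1≢0 (trans (sym (coefficient-at ones exponent exponent-injective t₀))
               (powerSum-vanishing (coefficient ones exponent) vanishes (2^t<q t₀)))
    where
      t₀ : Fin r
      t₀ = fromℕ< 0<r
      ones : Fin r → Carrier
      ones _ = 1#
      exponent : Fin r → ℕ
      exponent t = 2 ^ toℕ t
      exponent-injective : ∀ {t u} → exponent t ≡ exponent u → t ≡ u
      exponent-injective = FinP.toℕ-injective ∘ 2^-injective
      vanishes : ∀ y → sumF q (λ i → coefficient ones exponent (toℕ i) * pow y (toℕ i)) ≡ 0#
      vanishes y = begin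
        sumF q (λ i → coefficient ones exponent (toℕ i) * pow y (toℕ i))
          ≡⟨ sparse≡powerSum q ones exponent 2^t<q y ⟩
        sumF r (λ t → 1# * pow y (2 ^ toℕ t))  ≡⟨ sumF-cong r (λ t → *-identityˡ _) ⟩
        tr y                                     ≡⟨ tr≡0 y ⟩
        0#                                       ∎

  ⟪⟫-nondegenerate : ∀ c → (∀ y → ⟪ c , y ⟫ ≡ false) → c ≡ 0#
  ⟪⟫-nondegenerate c c⊥ with c ≟ 0#
  ... | yes c≡0 = c≡0
  ... | no c≢0  = ⊥-elim (tr-nonvanishing λ y → begin
    tr y                        ≡⟨ cong tr (sym (c*[c⁻¹*y]≡y y)) ⟩
    tr (c * (c⁻¹ * y))          ≡⟨ sym (ι⟪⟫ c _) ⟩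
    ι ⟪ c , c⁻¹ * y ⟫           ≡⟨ cong ι (c⊥ _) ⟩
    0#                          ∎)
    where
      c⁻¹ : Carrier
      c⁻¹ = (c ⁻¹) {c≢0}
      c*[c⁻¹*y]≡y : ∀ y → c * (c⁻¹ * y) ≡ y
      c*[c⁻¹*y]≡y y = trans (sym (*-assoc c c⁻¹ y)) (trans (cong (_* y) (x*x⁻¹≡1 c c≢0)) (*-identityˡ y))

  ⟪⟫-separating : ∀ {x} → x ≢ 0# → ∃ λ d → ⟪ d , x ⟫ ≡ true
  ⟪⟫-separating {x} x≢0 with FinP.any? (λ i → ⟪ element i , x ⟫ BoolP.≟ true)
  ... | yes (i , ⟪eᵢ,x⟫≡true) = element i , ⟪eᵢ,x⟫≡true
  ... | no none = ⊥-elim (x≢0 (⟪⟫-nondegenerate x λ y →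
        trans (⟪⟫-comm x y) (BoolP.¬-not λ ⟪y,x⟫≡true →
          none (index y , trans (cong (λ z → ⟪ z , x ⟫) (element-index y)) ⟪y,x⟫≡true))))

  -- Delsarte's theorem

  combination : ∀ {N} → (Fin N → Carrier) → (Fin N → Bool) → Carrier
  combination {N} t u = sumF N (λ j → ι (u j) * t j)

  InSpan : ∀ {N} → (Fin N → Carrier) → Carrier → Set
  InSpan t x = ∃ λ u → combination t u ≡ x

  dot-⟪⟫ : ∀ {N} (t : Fin N → Carrier) a u → dot (λ j → ⟪ a , t j ⟫) u ≡ ⟪ a , combination t u ⟫
  dot-⟪⟫ {zero}  t a u = sym (⟪⟫-zeroʳ a)
  dot-⟪⟫ {suc N} t a u = sym (begin
    ⟪ a , ι (u fz) * t fz + combination (t ∘ fs) (u ∘ fs) ⟫          ≡⟨ ⟪⟫-distribʳ a _ _ ⟩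
    ⟪ a , ι (u fz) * t fz ⟫ xor ⟪ a , combination (t ∘ fs) (u ∘ fs) ⟫  ≡⟨ cong₂ _xor_ (⟪⟫-ι*ʳ a (u fz) (t fz)) (sym (dot-⟪⟫ (t ∘ fs) a (u ∘ fs))) ⟩
    (⟪ a , t fz ⟫ ∧ u fz) xor dot (λ j → ⟪ a , t (fs j) ⟫) (u ∘ fs)  ∎)

  dot-congˡ : ∀ {N} {v w : Fin N → Bool} u → (∀ j → v j ≡ w j) → dot v u ≡ dot w u
  dot-congˡ {zero}  u v≗w = refl
  dot-congˡ {suc N} u v≗w = cong₂ _xor_ (cong (_∧ u fz) (v≗w fz)) (dot-congˡ (u ∘ fs) (v≗w ∘ fs))

  ⟪⟫-split : ∀ d x y → ⟪ d , x ⟫ ≡ ⟪ d , x + y ⟫ xor ⟪ d , y ⟫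
  ⟪⟫-split d x y = trans (cong (λ z → ⟪ d , z ⟫) x≡[x+y]+y) (⟪⟫-distribʳ d (x + y) y)
    where
      x≡[x+y]+y : x ≡ x + y + y
      x≡[x+y]+y = sym (trans (+-assoc x y y) (trans (cong (x +_) (x+x≡0 y)) (+-identityʳ x)))

  Separates : ∀ {N} → (Fin N → Carrier) → Carrier → Carrier → Set
  Separates t x d = (∀ j → ⟪ d , t j ⟫ ≡ false) × ⟪ d , x ⟫ ≡ true

  separate-from-span : ∀ {N} (t : Fin N → Carrier) x → ¬ InSpan t x → ∃ (Separates t x)
  separate-from-span {zero} t x x∉ with ⟪⟫-separating (λ x≡0 → x∉ ((λ ()) , sym x≡0))
  ... | d , ⟪d,x⟫≡true = d , (λ ()) , ⟪d,x⟫≡true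
  separate-from-span {suc N} t x x∉ =
    combine (separate-from-span (t ∘ fs) x x∉tail) (separate-from-span (t ∘ fs) (x + t fz) x+t₀∉tail)
    where
      t₀ : Carrier
      t₀ = t fz
      x∉tail : ¬ InSpan (t ∘ fs) x
      x∉tail (u , u↦x) = x∉ (false ∷ u , trans (cong (_+ combination (t ∘ fs) u) (zeroˡ t₀)) (trans (+-identityˡ _) u↦x))
      x+t₀∉tail : ¬ InSpan (t ∘ fs) (x + t₀)
      x+t₀∉tail (u , u↦x+t₀) = x∉ (true ∷ u , (begin
        1# * t₀ + combination (t ∘ fs) u  ≡⟨ cong₂ _+_ (*-identityˡ t₀) u↦x+t₀ ⟩
        t₀ + (x + t₀)                     ≡⟨ cong (t₀ +_) (+-comm x t₀) ⟩
        t₀ + (t₀ + x)                     ≡⟨ x+[x+y]≡y t₀ x ⟩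
        x                                 ∎))
      -- Either d₁ or d₂ already vanishes at t₀, or else d₁ + d₂ does.
      combine : ∃ (Separates (t ∘ fs) x) → ∃ (Separates (t ∘ fs) (x + t₀)) → ∃ (Separates t x)
      combine (d₁ , d₁⊥ , d₁x) (d₂ , d₂⊥ , d₂x+t₀) with ⟪ d₁ , t₀ ⟫ in d₁t₀ | ⟪ d₂ , t₀ ⟫ in d₂t₀
      ... | false | _     = d₁ , (λ { fz → d₁t₀ ; (fs j) → d₁⊥ j }) , d₁x
      ... | true  | false = d₂ , (λ { fz → d₂t₀ ; (fs j) → d₂⊥ j }) ,
                            trans (⟪⟫-split d₂ x t₀) (cong₂ _xor_ d₂x+t₀ d₂t₀)
      ... | true  | true  = d₁ + d₂ , sum⊥ , sum-x
        where
          sum⊥ : ∀ j → ⟪ d₁ + d₂ , t j ⟫ ≡ false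
          sum⊥ fz     = trans (⟪⟫-distribˡ d₁ d₂ t₀) (cong₂ _xor_ d₁t₀ d₂t₀)
          sum⊥ (fs j) = trans (⟪⟫-distribˡ d₁ d₂ _) (cong₂ _xor_ (d₁⊥ j) (d₂⊥ j))
          sum-x : ⟪ d₁ + d₂ , x ⟫ ≡ true
          sum-x = trans (⟪⟫-distribˡ d₁ d₂ x)
                    (cong₂ _xor_ d₁x (trans (⟪⟫-split d₂ x t₀) (cong₂ _xor_ d₂x+t₀ d₂t₀)))

  delsarte : ∀ {N} (t : Fin N → Carrier) (v : Fin N → Bool) →
    (∀ u → combination t u ≡ 0# → dot v u ≡ false) → ∃ λ a → ∀ j → ⟪ a , t j ⟫ ≡ v j
  delsarte {zero}  t v _  = 0# , λ ()
  delsarte {suc N} t v v⊥ = extend (delsarte (t ∘ fs) (v ∘ fs) v⊥tail)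
    where
      t₀ : Carrier
      t₀ = t fz
      v⊥tail : ∀ u → combination (t ∘ fs) u ≡ 0# → dot (v ∘ fs) u ≡ false
      v⊥tail u u↦0 = trans (cong (_xor dot (v ∘ fs) u) (sym (BoolP.∧-zeroʳ (v fz))))
        (v⊥ (false ∷ u) (trans (cong (_+ combination (t ∘ fs) u) (zeroˡ t₀)) (trans (+-identityˡ _) u↦0)))
      -- A functional fitting v on the tail but not at t₀ shows, by duality, that t₀ is outside
      -- the span of the tail; a functional separating t₀ from that span then corrects it.
      extend : (∃ λ a → ∀ j → ⟪ a , t (fs j) ⟫ ≡ v (fs j)) → ∃ λ a → ∀ j → ⟪ a , t j ⟫ ≡ v j
      extend (a , a-fits) with ⟪ a , t₀ ⟫ BoolP.≟ v fz
      ... | yes fits₀  = a , λ { fz → fits₀ ; (fs j) → a-fits j }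
      ... | no misfit₀ = correct (separate-from-span (t ∘ fs) t₀ t₀∉tail)
        where
          t₀∉tail : ¬ InSpan (t ∘ fs) t₀
          t₀∉tail (u , u↦t₀) = misfit₀ (sym (xor≡false⇒≡ (begin
            v fz xor ⟪ a , t₀ ⟫                                ≡⟨ cong₂ _xor_ (sym (BoolP.∧-identityʳ (v fz))) (cong (λ z → ⟪ a , z ⟫) (sym u↦t₀)) ⟩
            (v fz ∧ true) xor ⟪ a , combination (t ∘ fs) u ⟫  ≡⟨ cong ((v fz ∧ true) xor_) (sym (dot-⟪⟫ (t ∘ fs) a u)) ⟩
            (v fz ∧ true) xor dot (λ j → ⟪ a , t (fs j) ⟫) u  ≡⟨ cong ((v fz ∧ true) xor_) (dot-congˡ u a-fits) ⟩
            (v fz ∧ true) xor dot (v ∘ fs) u                    ≡⟨ v⊥ (true ∷ u) (trans (cong₂ _+_ (*-identityˡ t₀) u↦t₀) (x+x≡0 t₀)) ⟩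
            false                                               ∎)))
          correct : ∃ (Separates (t ∘ fs) t₀) → ∃ λ a → ∀ j → ⟪ a , t j ⟫ ≡ v j
          correct (d , d⊥ , ⟪d,t₀⟫≡true) = a + d , λ
            { fz     → trans (⟪⟫-distribˡ a d t₀) (trans (cong (⟪ a , t₀ ⟫ xor_) ⟪d,t₀⟫≡true) (≢⇒xor-true≡ misfit₀))
            ; (fs j) → trans (⟪⟫-distribˡ a d _) (trans (cong₂ _xor_ (a-fits j) (d⊥ j)) (BoolP.xor-identityʳ _))
            }

  HasTrivialAnnihilator : ∀ {N} → (Fin N → Carrier) → Set
  HasTrivialAnnihilator t = ∀ c → (∀ j → ⟪ c , t j ⟫ ≡ false) → c ≡ 0#

  linIso : ∀ n {N} (g : Fin N → Mat (n ℕ.+ n)) → HasTrivialAnnihilator (Tr ∘ g) → LinIso n g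
  linIso n g trivial = dual , additive , homogeneous , injective , surjective
    where
      dual : ∀ a → InDual n g (cw n g a)
      dual a u u∈C = trans (dot-⟪⟫ (Tr ∘ g) a u) (trans (cong (λ z → ⟪ a , z ⟫) u∈C) (⟪⟫-zeroʳ a))
      additive : ∀ a b j → cw n g (a + b) j ≡ (cw n g a j xor cw n g b j)
      additive a b j = ⟪⟫-distribˡ a b (Tr (g j))
      homogeneous : ∀ e a j → cw n g (ι e * a) j ≡ (e ∧ cw n g a j)
      homogeneous e a j = ⟪⟫-ι*ˡ e a (Tr (g j))
      injective : ∀ a b → (∀ j → cw n g a j ≡ cw n g b j) → a ≡ b
      injective a b same = x+y≡0⇒x≡y (trivial (a + b) λ j →
        trans (⟪⟫-distribˡ a b _) (trans (cong (_xor cw n g b j) (same j)) (BoolP.xor-same (cw n g b j))))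
      surjective : ∀ v → InDual n g v → Σ Carrier λ a → ∀ j → cw n g a j ≡ v j
      surjective v v∈C⊥ = delsarte (Tr ∘ g) v v∈C⊥

  Tr-cong : ∀ {m} {X Y : Mat m} → X ≡ₘ Y → Tr X ≡ Tr Y
  Tr-cong {m} X≡Y = sumF-cong m (λ i → X≡Y i i)

  dcIso-fromTraces : ∀ n s (W : Carrier → Set) →
    (∀ c → (∀ x → W x → ⟪ c , x ⟫ ≡ false) → c ≡ 0#) →
    (∀ x → W x → ∃ λ h → InDC n s h × Tr h ≡ x) → DCIso n s
  dcIso-fromTraces n s W W-separating W-traces N g (_ , _ , covers) = linIso n g trivial
    where
      trivial : HasTrivialAnnihilator (Tr ∘ g)
      trivial c c⊥ = W-separating c (λ x x∈W → vanishes (W-traces x x∈W))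
        where
          vanishes : ∀ {x} → (∃ λ h → InDC n s h × Tr h ≡ x) → ⟪ c , x ⟫ ≡ false
          vanishes (h , h∈DC , Trh≡x) with covers h h∈DC
          ... | j , gⱼ≡h = trans (cong (λ z → ⟪ c , z ⟫) (trans (sym Trh≡x) (sym (Tr-cong gⱼ≡h)))) (c⊥ j)

  -- Traces in the double cosets P⁺ σ_s⁺ P⁺

  δ≡δℕ : ∀ {m} (i j : Fin m) → δ i j ≡ δℕ (toℕ i) (toℕ j)
  δ≡δℕ i j with toℕ i ℕ.≟ toℕ j
  ... | yes _ = refl
  ... | no _  = refl

  δ-refl : ∀ {m} (i : Fin m) → δ i i ≡ 1#
  δ-refl i = trans (δ≡δℕ i i) (δℕ-refl (toℕ i))

  δ-≢ : ∀ {m} {i j : Fin m} → i ≢ j → δ i j ≡ 0#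
  δ-≢ {i = i} {j} i≢j = trans (δ≡δℕ i j) (δℕ-≢ (i≢j ∘ FinP.toℕ-injective))

  δ-sym : ∀ {m} (i j : Fin m) → δ i j ≡ δ j i
  δ-sym i j with i FinP.≟ j
  ... | yes refl = refl
  ... | no i≢j   = trans (δ-≢ i≢j) (sym (δ-≢ (i≢j ∘ sym)))

  δ-sumˡ : ∀ m (i : Fin m) (f : Fin m → Carrier) → sumF m (λ k → δ i k * f k) ≡ f i
  δ-sumˡ m i f = trans (sumF-single m _ i (λ k k≢i → trans (cong (_* f k) (δ-≢ (k≢i ∘ sym))) (zeroˡ (f k))))
                       (trans (cong (_* f i) (δ-refl i)) (*-identityˡ (f i)))

  δ-sumʳ : ∀ m (i : Fin m) (f : Fin m → Carrier) → sumF m (λ k → f k * δ k i) ≡ f i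
  δ-sumʳ m i f = trans (sumF-cong m (λ k → trans (*-comm (f k) _) (cong (_* f k) (δ-sym k i)))) (δ-sumˡ m i f)

  ·-identityʳ : ∀ {m} (X I : Mat m) → I ≡ₘ idM → (X · I) ≡ₘ X
  ·-identityʳ {m} X I I≡δ i j = trans (sumF-cong m (λ k → cong (X i k *_) (I≡δ k j))) (δ-sumʳ m j (X i))

  unipotent-square : ∀ {m} (N : Mat m) → (N · N) ≡ₘ zeroM →
    ((λ i j → δ i j + N i j) · (λ i j → δ i j + N i j)) ≡ₘ idM
  unipotent-square {m} N N²≡0 i j = begin
    sumF m (λ k → (δ i k + N i k) * (δ k j + N k j))
      ≡⟨ sumF-cong m (λ k → expand (δ i k) (N i k) (δ k j) (N k j)) ⟩
    sumF m (λ k → (δ i k * δ k j + δ i k * N k j) + (N i k * δ k j + N i k * N k j))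
      ≡⟨ sumF-distrib-+ m _ _ ⟩
    sumF m (λ k → δ i k * δ k j + δ i k * N k j) + sumF m (λ k → N i k * δ k j + N i k * N k j)
      ≡⟨ cong₂ _+_ (sumF-distrib-+ m _ _) (sumF-distrib-+ m _ _) ⟩
    (sumF m (λ k → δ i k * δ k j) + sumF m (λ k → δ i k * N k j))
      + (sumF m (λ k → N i k * δ k j) + (N · N) i j)
      ≡⟨ cong₂ _+_ (cong₂ _+_ (δ-sumˡ m i (λ k → δ k j)) (δ-sumˡ m i (λ k → N k j)))
                   (cong₂ _+_ (δ-sumʳ m j (N i)) (N²≡0 i j)) ⟩
    (δ i j + N i j) + (N i j + 0#)
      ≡⟨ [a+b]+[b+c]≡a+c (δ i j) (N i j) 0# ⟩
    δ i j + 0#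
      ≡⟨ +-identityʳ (δ i j) ⟩
    δ i j ∎
    where
      expand : ∀ a b c d → (a + b) * (c + d) ≡ (a * c + a * d) + (b * c + b * d)
      expand a b c d = trans (distribʳ (c + d) a b) (cong₂ _+_ (distribˡ a c d) (distribˡ b c d))

  block-↑ˡ↑ˡ : ∀ {n} (A B C D : Mat n) i j → block A B C D (i ↑ˡ n) (j ↑ˡ n) ≡ A i j
  block-↑ˡ↑ˡ {n} A B C D i j rewrite FinP.splitAt-↑ˡ n i n | FinP.splitAt-↑ˡ n j n = refl

  block-↑ˡ↑ʳ : ∀ {n} (A B C D : Mat n) i j → block A B C D (i ↑ˡ n) (n ↑ʳ j) ≡ B i j
  block-↑ˡ↑ʳ {n} A B C D i j rewrite FinP.splitAt-↑ˡ n i n | FinP.splitAt-↑ʳ n n j = refl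

  block-↑ʳ↑ˡ : ∀ {n} (A B C D : Mat n) i j → block A B C D (n ↑ʳ i) (j ↑ˡ n) ≡ C i j
  block-↑ʳ↑ˡ {n} A B C D i j rewrite FinP.splitAt-↑ʳ n n i | FinP.splitAt-↑ˡ n j n = refl

  block-↑ʳ↑ʳ : ∀ {n} (A B C D : Mat n) i j → block A B C D (n ↑ʳ i) (n ↑ʳ j) ≡ D i j
  block-↑ʳ↑ʳ {n} A B C D i j rewrite FinP.splitAt-↑ʳ n n i | FinP.splitAt-↑ʳ n n j = refl

  data Halves (n : ℕ) : Fin (n ℕ.+ n) → Set where
    left  : ∀ k → Halves n (k ↑ˡ n)
    right : ∀ k → Halves n (n ↑ʳ k)

  halves : ∀ {n} (i : Fin (n ℕ.+ n)) → Halves n i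
  halves {n} i with splitAt n i in eq
  ... | inj₁ k rewrite sym (FinP.splitAt⁻¹-↑ˡ eq) = left k
  ... | inj₂ k rewrite sym (FinP.splitAt⁻¹-↑ʳ eq) = right k

  ↑ˡ≢↑ʳ : ∀ {n} (k l : Fin n) → k ↑ˡ n ≢ n ↑ʳ l
  ↑ˡ≢↑ʳ {n} k l k≡l = ℕP.<⇒≢ (ℕP.<-≤-trans (FinP.toℕ<n k) (ℕP.m≤m+n n (toℕ l)))
    (trans (sym (FinP.toℕ-↑ˡ k n)) (trans (cong toℕ k≡l) (FinP.toℕ-↑ʳ n l)))

  δ-injective : ∀ {m m′} (f : Fin m → Fin m′) → (∀ i j → f i ≡ f j → i ≡ j) → ∀ i j → δ (f i) (f j) ≡ δ i j
  δ-injective f f-injective i j with i FinP.≟ j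
  ... | yes refl = trans (δ-refl (f i)) (sym (δ-refl i))
  ... | no i≢j   = trans (δ-≢ (i≢j ∘ f-injective i j)) (sym (δ-≢ i≢j))

  parabolic : ∀ {n} → Mat n → Mat n → Mat n → Mat (n ℕ.+ n)
  parabolic A B C = block A (A · B) zeroM C

  parabolic-identity : ∀ {n} → parabolic {n} idM zeroM idM ≡ₘ idM
  parabolic-identity {n} i j with halves {n} i | halves {n} j
  ... | left k  | left l  = trans (block-↑ˡ↑ˡ idM _ zeroM idM k l) (sym (δ-injective (_↑ˡ n) (FinP.↑ˡ-injective n) k l))
  ... | left k  | right l = trans (block-↑ˡ↑ʳ idM _ zeroM idM k l) (trans (sumF-zero n (λ _ → zeroʳ _)) (sym (δ-≢ (↑ˡ≢↑ʳ k l))))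
  ... | right k | left l  = trans (block-↑ʳ↑ˡ idM _ zeroM idM k l) (sym (δ-≢ (↑ˡ≢↑ʳ l k ∘ sym)))
  ... | right k | right l = trans (block-↑ʳ↑ʳ idM _ zeroM idM k l) (sym (δ-injective (n ↑ʳ_) (FinP.↑ʳ-injective n) k l))

  InP-parabolic : ∀ {n} (A B C : Mat n) → (C · transpose A) ≡ₘ idM → (∀ i j → B i j ≡ B j i) → (∀ i → B i i ≡ 0#) →
    InP n (parabolic A B C)
  InP-parabolic A B C C·ᵗA≡1 B-symmetric B-alternating = A , C , B , C·ᵗA≡1 , B-symmetric , B-alternating , λ _ _ → refl

  swapℕ-left< : ∀ {n s k} → k < s → swapℕ n s k ≡ n ℕ.+ k
  swapℕ-left< {n} {s} {k} k<s with k ℕ.<? s | k ∸ n ℕ.<? s | n ℕ.≤? k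
  ... | yes _  | _ | _ = ℕP.+-comm k n
  ... | no k≮s | _ | _ = ⊥-elim (k≮s k<s)

  swapℕ-left≥ : ∀ {n s k} → k < n → ¬ k < s → swapℕ n s k ≡ k
  swapℕ-left≥ {n} {s} {k} k<n k≮s with k ℕ.<? s | k ∸ n ℕ.<? s | n ℕ.≤? k
  ... | yes k<s | _     | _      = ⊥-elim (k≮s k<s)
  ... | no _    | yes _ | yes n≤k = ⊥-elim (ℕP.<⇒≱ k<n n≤k)
  ... | no _    | yes _ | no _   = refl
  ... | no _    | no _  | _      = refl

  swapℕ-right< : ∀ {n s k} → s ≤ n → k < s → swapℕ n s (n ℕ.+ k) ≡ k
  swapℕ-right< {n} {s} {k} s≤n k<s with n ℕ.+ k ℕ.<? s | n ℕ.+ k ∸ n ℕ.<? s | n ℕ.≤? n ℕ.+ k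
  ... | yes n+k<s | _        | _      = ⊥-elim (ℕP.<⇒≱ n+k<s (ℕP.≤-trans s≤n (ℕP.m≤m+n n k)))
  ... | no _      | yes _    | yes _  = ℕP.m+n∸m≡n n k
  ... | no _      | yes _    | no n≰ = ⊥-elim (n≰ (ℕP.m≤m+n n k))
  ... | no _      | no k≮s′  | _      = ⊥-elim (k≮s′ (subst (_< s) (sym (ℕP.m+n∸m≡n n k)) k<s))

  swapℕ-right≥ : ∀ {n s k} → s ≤ n → ¬ k < s → swapℕ n s (n ℕ.+ k) ≡ n ℕ.+ k
  swapℕ-right≥ {n} {s} {k} s≤n k≮s with n ℕ.+ k ℕ.<? s | n ℕ.+ k ∸ n ℕ.<? s | n ℕ.≤? n ℕ.+ k
  ... | yes n+k<s | _        | _     = ⊥-elim (ℕP.<⇒≱ n+k<s (ℕP.≤-trans s≤n (ℕP.m≤m+n n k)))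
  ... | no _      | yes k<s′ | yes _ = ⊥-elim (k≮s (subst (_< s) (ℕP.m+n∸m≡n n k) k<s′))
  ... | no _      | yes _    | no _  = refl
  ... | no _      | no _     | _     = refl

  swapℕ-↑ˡ< : ∀ {n s} (k : Fin n) → toℕ k < s → swapℕ n s (toℕ (k ↑ˡ n)) ≡ toℕ (n ↑ʳ k)
  swapℕ-↑ˡ< {n} k k<s rewrite FinP.toℕ-↑ˡ k n | FinP.toℕ-↑ʳ n k = swapℕ-left< k<s

  swapℕ-↑ˡ≥ : ∀ {n s} (k : Fin n) → ¬ toℕ k < s → swapℕ n s (toℕ (k ↑ˡ n)) ≡ toℕ (k ↑ˡ n)
  swapℕ-↑ˡ≥ {n} k k≮s rewrite FinP.toℕ-↑ˡ k n = swapℕ-left≥ (FinP.toℕ<n k) k≮s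

  swapℕ-↑ʳ< : ∀ {n s} → s ≤ n → (k : Fin n) → toℕ k < s → swapℕ n s (toℕ (n ↑ʳ k)) ≡ toℕ (k ↑ˡ n)
  swapℕ-↑ʳ< {n} s≤n k k<s rewrite FinP.toℕ-↑ˡ k n | FinP.toℕ-↑ʳ n k = swapℕ-right< s≤n k<s

  swapℕ-↑ʳ≥ : ∀ {n s} → s ≤ n → (k : Fin n) → ¬ toℕ k < s → swapℕ n s (toℕ (n ↑ʳ k)) ≡ toℕ (n ↑ʳ k)
  swapℕ-↑ʳ≥ {n} s≤n k k≮s rewrite FinP.toℕ-↑ʳ n k = swapℕ-right≥ s≤n k≮s

  swapℕ-involutive : ∀ {n s} → s ≤ n → (i : Fin (n ℕ.+ n)) → swapℕ n s (swapℕ n s (toℕ i)) ≡ toℕ i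
  swapℕ-involutive {n} {s} s≤n i with halves {n} i
  ... | left k  = onLeft (toℕ k ℕ.<? s)
    where
      onLeft : Dec (toℕ k < s) → swapℕ n s (swapℕ n s (toℕ (k ↑ˡ n))) ≡ toℕ (k ↑ˡ n)
      onLeft (yes k<s) = trans (cong (swapℕ n s) (swapℕ-↑ˡ< k k<s)) (swapℕ-↑ʳ< s≤n k k<s)
      onLeft (no k≮s)  = trans (cong (swapℕ n s) (swapℕ-↑ˡ≥ k k≮s)) (swapℕ-↑ˡ≥ k k≮s)
  ... | right k = onRight (toℕ k ℕ.<? s)
    where
      onRight : Dec (toℕ k < s) → swapℕ n s (swapℕ n s (toℕ (n ↑ʳ k))) ≡ toℕ (n ↑ʳ k)
      onRight (yes k<s) = trans (cong (swapℕ n s) (swapℕ-↑ʳ< s≤n k k<s)) (swapℕ-↑ˡ< k k<s)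
      onRight (no k≮s)  = trans (cong (swapℕ n s) (swapℕ-↑ʳ≥ s≤n k k≮s)) (swapℕ-↑ʳ≥ s≤n k k≮s)

  σ≡δℕ : ∀ n s (i j : Fin (n ℕ.+ n)) → σ n s i j ≡ δℕ (toℕ j) (swapℕ n s (toℕ i))
  σ≡δℕ n s i j with toℕ j ℕ.≟ swapℕ n s (toℕ i)
  ... | yes _ = refl
  ... | no _  = refl

  ·σ-diagonal : ∀ {n s} → s ≤ n → (X : Mat (n ℕ.+ n)) (i l : Fin (n ℕ.+ n)) →
    toℕ l ≡ swapℕ n s (toℕ i) → (X · σ n s) i i ≡ X i l
  ·σ-diagonal {n} {s} s≤n X i l l↦i = begin
    sumF (n ℕ.+ n) (λ k → X i k * σ n s k i)  ≡⟨ sumF-single _ _ l off ⟩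
    X i l * σ n s l i                          ≡⟨ cong (X i l *_) (trans (σ≡δℕ n s l i) (trans (cong (δℕ (toℕ i)) i↦l) (δℕ-refl (toℕ i)))) ⟩
    X i l * 1#                                 ≡⟨ *-identityʳ (X i l) ⟩
    X i l                                      ∎
    where
      i↦l : swapℕ n s (toℕ l) ≡ toℕ i
      i↦l = trans (cong (swapℕ n s) l↦i) (swapℕ-involutive s≤n i)
      off : ∀ k → k ≢ l → X i k * σ n s k i ≡ 0#
      off k k≢l = trans (cong (X i k *_) (trans (σ≡δℕ n s k i) (δℕ-≢ i≢swapk))) (zeroʳ (X i k))
        where
          i≢swapk : toℕ i ≢ swapℕ n s (toℕ k)
          i≢swapk i≡swapk = k≢l (FinP.toℕ-injective (begin
            toℕ k                            ≡⟨ sym (swapℕ-involutive s≤n k) ⟩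
            swapℕ n s (swapℕ n s (toℕ k))    ≡⟨ cong (swapℕ n s) (sym i≡swapk) ⟩
            swapℕ n s (toℕ i)                ≡⟨ sym l↦i ⟩
            toℕ l                            ∎))

  -- The sum of the diagonal entries of block A B C D · σ n s at k ↑ˡ n and at n ↑ʳ k.
  σ-diagonalPair : ∀ {n} → ℕ → (A B C D : Mat n) → Fin n → Carrier
  σ-diagonalPair s A B C D k with toℕ k ℕ.<? s
  ... | yes _ = B k k + C k k
  ... | no _  = A k k + D k k

  σ-diagonalPair-< : ∀ {n s} (A B C D : Mat n) k → toℕ k < s → σ-diagonalPair s A B C D k ≡ B k k + C k k
  σ-diagonalPair-< {s = s} A B C D k k<s with toℕ k ℕ.<? s
  ... | yes _  = refl
  ... | no k≮s = ⊥-elim (k≮s k<s)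

  σ-diagonalPair-≥ : ∀ {n s} (A B C D : Mat n) k → ¬ toℕ k < s → σ-diagonalPair s A B C D k ≡ A k k + D k k
  σ-diagonalPair-≥ {s = s} A B C D k k≮s with toℕ k ℕ.<? s
  ... | yes k<s = ⊥-elim (k≮s k<s)
  ... | no _    = refl

  Tr-block·σ : ∀ {n s} → s ≤ n → (A B C D : Mat n) → Tr (block A B C D · σ n s) ≡ sumF n (σ-diagonalPair s A B C D)
  Tr-block·σ {n} {s} s≤n A B C D = begin
    sumF (n ℕ.+ n) (λ i → Y i i)                                         ≡⟨ sumF-splitAt n n _ ⟩
    sumF n (λ k → Y (k ↑ˡ n) (k ↑ˡ n)) + sumF n (λ k → Y (n ↑ʳ k) (n ↑ʳ k))  ≡⟨ sym (sumF-distrib-+ n _ _) ⟩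
    sumF n (λ k → Y (k ↑ˡ n) (k ↑ˡ n) + Y (n ↑ʳ k) (n ↑ʳ k))            ≡⟨ sumF-cong n (λ k → pair k (toℕ k ℕ.<? s)) ⟩
    sumF n (σ-diagonalPair s A B C D)                                    ∎
    where
      X Y : Mat (n ℕ.+ n)
      X = block A B C D
      Y = X · σ n s
      pair : ∀ k → Dec (toℕ k < s) → Y (k ↑ˡ n) (k ↑ˡ n) + Y (n ↑ʳ k) (n ↑ʳ k) ≡ σ-diagonalPair s A B C D k
      pair k (yes k<s) = trans
        (cong₂ _+_ (trans (·σ-diagonal s≤n X (k ↑ˡ n) (n ↑ʳ k) (sym (swapℕ-↑ˡ< k k<s))) (block-↑ˡ↑ʳ A B C D k k))
                   (trans (·σ-diagonal s≤n X (n ↑ʳ k) (k ↑ˡ n) (sym (swapℕ-↑ʳ< s≤n k k<s))) (block-↑ʳ↑ˡ A B C D k k)))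
        (sym (σ-diagonalPair-< A B C D k k<s))
      pair k (no k≮s) = trans
        (cong₂ _+_ (trans (·σ-diagonal s≤n X (k ↑ˡ n) (k ↑ˡ n) (sym (swapℕ-↑ˡ≥ k k≮s))) (block-↑ˡ↑ˡ A B C D k k))
                   (trans (·σ-diagonal s≤n X (n ↑ʳ k) (n ↑ʳ k) (sym (swapℕ-↑ʳ≥ s≤n k k≮s))) (block-↑ʳ↑ʳ A B C D k k)))
        (sym (σ-diagonalPair-≥ A B C D k k≮s))

  -- p σ_s 1, with the identity written as an element of P⁺ to match the shape required by InDC.
  cosetElement : ∀ {n} → ℕ → Mat n → Mat n → Mat n → Mat (n ℕ.+ n)
  cosetElement {n} s A B C = (parabolic A B C · σ n s) · parabolic {n} idM zeroM idM

  InDC-cosetElement : ∀ {n} s (A B C : Mat n) → (C · transpose A) ≡ₘ idM →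
    (∀ i j → B i j ≡ B j i) → (∀ i → B i i ≡ 0#) → InDC n s (cosetElement s A B C)
  InDC-cosetElement {n} s A B C C·ᵗA≡1 B-symmetric B-alternating =
    parabolic A B C , parabolic {n} idM zeroM idM , InP-parabolic A B C C·ᵗA≡1 B-symmetric B-alternating ,
    InP-parabolic idM zeroM idM (λ i j → trans (δ-sumˡ n i (δ j)) (δ-sym j i)) (λ _ _ → refl) (λ _ → refl) ,
    λ _ _ → refl

  Tr-cosetElement : ∀ {n s} → s ≤ n → (A B C : Mat n) →
    Tr (cosetElement s A B C) ≡ sumF n (σ-diagonalPair s A (A · B) zeroM C)
  Tr-cosetElement {n} {s} s≤n A B C =
    trans (Tr-cong (·-identityʳ {n ℕ.+ n} _ _ (parabolic-identity {n}))) (Tr-block·σ {n} {s} s≤n A (A · B) zeroM C)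

  Tr-cosetElement-0 : ∀ {n} (A B C : Mat n) → Tr (cosetElement 0 A B C) ≡ Tr A + Tr C
  Tr-cosetElement-0 {n} A B C =
    trans (Tr-cosetElement {n} {0} z≤n A B C)
      (trans (sumF-cong n (λ k → σ-diagonalPair-≥ {n} {0} A (A · B) zeroM C k λ ())) (sumF-distrib-+ n _ _))

  lowerCorner : ∀ {m} → Carrier → Mat (suc (suc m))
  lowerCorner x (fs fz) fz = x
  lowerCorner x _       _  = 0#

  lowerCorner-square : ∀ {m} x → (lowerCorner {m} x · lowerCorner x) ≡ₘ zeroM
  lowerCorner-square {m} x i j = sumF-zero (suc (suc m)) (product-zero i j)
    where
      product-zero : ∀ i j k → lowerCorner {m} x i k * lowerCorner x k j ≡ 0#
      product-zero i           j fz     = zeroʳ _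
      product-zero fz          j (fs k) = zeroˡ _
      product-zero (fs fz)     j (fs k) = zeroˡ _
      product-zero (fs (fs i)) j (fs k) = zeroˡ _

  lowerCorner-column-suc : ∀ {m} x (l : Fin (suc (suc m))) k → lowerCorner x l (fs k) ≡ 0#
  lowerCorner-column-suc x fz          k = refl
  lowerCorner-column-suc x (fs fz)     k = refl
  lowerCorner-column-suc x (fs (fs l)) k = refl

  unitriangular : ∀ {m} → Carrier → Mat (suc (suc m))
  unitriangular x i j = δ i j + lowerCorner x i j

  hyperbolic : ∀ {m} → Mat (suc (suc m))
  hyperbolic i j = lowerCorner 1# i j + lowerCorner 1# j i

  ᵗunitriangular·hyperbolic-00 : ∀ {m} x → (transpose (unitriangular {m} x) · hyperbolic {m}) fz fz ≡ x
  ᵗunitriangular·hyperbolic-00 {m} x = begin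
    A fz fz * B fz fz + (A fz (fs fz) * B (fs fz) fz + sumF m (λ l → A fz (fs (fs l)) * B (fs (fs l)) fz))
      ≡⟨ cong₂ _+_ (trans (cong (A fz fz *_) (+-identityʳ 0#)) (zeroʳ _))
                   (cong₂ _+_ A₀₁B₁₀≡x (sumF-zero m (λ l → trans (cong (A fz (fs (fs l)) *_) (+-identityʳ 0#)) (zeroʳ _)))) ⟩
    0# + (x + 0#)
      ≡⟨ trans (+-identityˡ _) (+-identityʳ x) ⟩
    x ∎
    where
      A B : Mat (suc (suc m))
      A = transpose (unitriangular x)
      B = hyperbolic
      A₀₁B₁₀≡x : (δ {suc (suc m)} (fs fz) fz + x) * (1# + 0#) ≡ x
      A₀₁B₁₀≡x = trans (cong₂ _*_ (trans (cong (_+ x) (δ-≢ {suc (suc m)} {fs fz} {fz} λ ())) (+-identityˡ x)) (+-identityʳ 1#)) (*-identityʳ x)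

  ᵗunitriangular·hyperbolic-suc : ∀ {m} x k → (transpose (unitriangular {m} x) · hyperbolic {m}) (fs k) (fs k) ≡ 0#
  ᵗunitriangular·hyperbolic-suc {m} x k = begin
    sumF n (λ l → (δ l (fs k) + lowerCorner x l (fs k)) * hyperbolic l (fs k))
      ≡⟨ sumF-cong n (λ l → cong (_* hyperbolic l (fs k)) (trans (cong (δ l (fs k) +_) (lowerCorner-column-suc x l k))
                                                                 (trans (+-identityʳ _) (δ-sym l (fs k))))) ⟩
    sumF n (λ l → δ (fs k) l * hyperbolic l (fs k))
      ≡⟨ δ-sumˡ n (fs k) (λ l → hyperbolic l (fs k)) ⟩
    hyperbolic (fs k) (fs k)
      ≡⟨ x+x≡0 _ ⟩
    0# ∎
    where
      n : ℕ
      n = suc (suc m)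

  -- With A = ᵗC, C = unitriangular x = ᵗA⁻¹ and B = hyperbolic, the first diagonal pair of p σ_s
  -- contributes (A B)₀₀ = x to the trace and every other pair contributes 0.
  traces-n≥2 : ∀ {m s} → 1 ≤ s → s ≤ suc (suc m) → ∀ x →
    ∃ λ h → InDC (suc (suc m)) s h × Tr h ≡ x
  traces-n≥2 {m} {s} 1≤s s≤n x =
    cosetElement s A B C , InDC-cosetElement s A B C C·C≡1 (λ i j → +-comm _ _) (λ i → x+x≡0 _) , (begin
      Tr (cosetElement s A B C)            ≡⟨ Tr-cosetElement s≤n A B C ⟩
      term fz + sumF (suc m) (term ∘ fs)   ≡⟨ cong₂ _+_ term₀≡x (sumF-zero (suc m) (λ k → term-suc k (toℕ (fs k) ℕ.<? s))) ⟩
      x + 0#                               ≡⟨ +-identityʳ x ⟩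
      x                                    ∎)
    where
      A B C : Mat (suc (suc m))
      C = unitriangular x
      A = transpose C
      B = hyperbolic
      C·C≡1 : (C · transpose A) ≡ₘ idM
      C·C≡1 = unipotent-square (lowerCorner x) (lowerCorner-square x)
      term : Fin (suc (suc m)) → Carrier
      term = σ-diagonalPair s A (A · B) zeroM C
      term₀≡x : term fz ≡ x
      term₀≡x = trans (σ-diagonalPair-< A (A · B) zeroM C fz 1≤s) (trans (+-identityʳ _) (ᵗunitriangular·hyperbolic-00 {m} x))
      term-suc : ∀ k → Dec (toℕ (fs k) < s) → term (fs k) ≡ 0#
      term-suc k (yes k<s) = trans (σ-diagonalPair-< A (A · B) zeroM C (fs k) k<s)
                                   (trans (+-identityʳ _) (ᵗunitriangular·hyperbolic-suc {m} x k))
      term-suc k (no k≮s)  = trans (σ-diagonalPair-≥ A (A · B) zeroM C (fs k) k≮s) (x+x≡0 (C (fs k) (fs k)))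

  traces-2-0 : ∀ x → x ≢ 1# → ∃ λ h → InDC 2 0 h × Tr h ≡ x
  traces-2-0 x x≢1 =
    cosetElement 0 A zeroM C , InDC-cosetElement 0 A zeroM C C·ᵗA≡1 (λ _ _ → refl) (λ _ → refl) , (begin
      Tr (cosetElement 0 A zeroM C)          ≡⟨ Tr-cosetElement-0 A zeroM C ⟩
      (x + (1# + 0#)) + (w + (x * w + 0#))    ≡⟨ cong₂ _+_ (cong (x +_) (+-identityʳ 1#)) (trans (cong (w +_) (+-identityʳ _)) (+-comm w _)) ⟩
      (x + 1#) + (x * w + w)                  ≡⟨ cong ((x + 1#) +_) xw+w≡1 ⟩
      (x + 1#) + 1#                           ≡⟨ trans (+-assoc x 1# 1#) (cong (x +_) char2) ⟩
      x + 0#                                  ≡⟨ +-identityʳ x ⟩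
      x                                       ∎)
    where
      x+1≢0 : x + 1# ≢ 0#
      x+1≢0 = x≢1 ∘ x+y≡0⇒x≡y
      w : Carrier
      w = ((x + 1#) ⁻¹) {x+1≢0}
      xw+w≡1 : x * w + w ≡ 1#
      xw+w≡1 = begin
        x * w + w        ≡⟨ cong (x * w +_) (sym (*-identityˡ w)) ⟩
        x * w + 1# * w   ≡⟨ sym (distribʳ w x 1#) ⟩
        (x + 1#) * w     ≡⟨ x*x⁻¹≡1 (x + 1#) x+1≢0 ⟩
        1#               ∎
      -- A = [[x, 1], [1, 1]] and C = ᵗA⁻¹ = w [[1, 1], [1, x]] with w = (x + 1)⁻¹, so Tr A + Tr C = x.
      A C : Mat 2
      A fz fz = x
      A _  _  = 1#
      C (fs fz) (fs fz) = x * w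
      C _       _       = w
      C·ᵗA≡1 : (C · transpose A) ≡ₘ idM
      C·ᵗA≡1 fz      fz      = trans (cong₂ _+_ (*-comm w x) (trans (+-identityʳ _) (*-identityʳ w))) xw+w≡1
      C·ᵗA≡1 fz      (fs fz) = trans (cong (w * 1# +_) (+-identityʳ _)) (x+x≡0 _)
      C·ᵗA≡1 (fs fz) fz      = trans (cong (w * x +_) (trans (+-identityʳ _) (trans (*-identityʳ _) (*-comm x w)))) (x+x≡0 _)
      C·ᵗA≡1 (fs fz) (fs fz) =
        trans (cong₂ _+_ (*-identityʳ w) (trans (+-identityʳ _) (*-identityʳ _))) (trans (+-comm w _) xw+w≡1)

  InverseSum : Carrier → Set
  InverseSum x = Σ Carrier λ a → Σ (a ≢ 0#) λ a≢0 → a + (a ⁻¹) {a≢0} ≡ x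

  traces-1-0 : ∀ x → InverseSum x → ∃ λ h → InDC 1 0 h × Tr h ≡ x
  traces-1-0 x (a , a≢0 , a+a⁻¹≡x) =
    cosetElement 0 A zeroM C , InDC-cosetElement 0 A zeroM C C·ᵗA≡1 (λ _ _ → refl) (λ _ → refl) ,
    trans (Tr-cosetElement-0 A zeroM C) (trans (cong₂ _+_ (+-identityʳ a) (+-identityʳ a⁻¹)) a+a⁻¹≡x)
    where
      a⁻¹ : Carrier
      a⁻¹ = (a ⁻¹) {a≢0}
      A C : Mat 1
      A _ _ = a
      C _ _ = a⁻¹
      C·ᵗA≡1 : (C · transpose A) ≡ₘ idM
      C·ᵗA≡1 fz fz = trans (+-identityʳ _) (trans (*-comm a⁻¹ a) (x*x⁻¹≡1 a a≢0))

  -- Nondegeneracy on the traces of the double cosets with n ≤ 2 and s = 0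

  third-element : 2 ≤ r → ∃ λ z → z ≢ 0# × z ≢ 1#
  third-element 2≤r with FinP.any? (λ i → ¬? (element i ≟ 0#) ×-dec ¬? (element i ≟ 1#))
  ... | yes (i , eᵢ≢0 , eᵢ≢1) = element i , eᵢ≢0 , eᵢ≢1
  ... | no none = ⊥-elim (ℕP.<⇒≱ 2<q (FinP.injective⇒≤ {f = isZero ∘ element} isZero-injective))
    where
      2<q : 2 < q
      2<q = ℕP.<-≤-trans (s≤s (s≤s (s≤s z≤n))) (ℕP.^-monoʳ-≤ 2 2≤r)
      isZero : Carrier → Fin 2
      isZero y with y ≟ 0#
      ... | yes _ = fz
      ... | no _  = fs fz
      only-0-1 : ∀ i → element i ≢ 0# → element i ≡ 1#
      only-0-1 i eᵢ≢0 with element i ≟ 1#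
      ... | yes eᵢ≡1 = eᵢ≡1
      ... | no eᵢ≢1  = ⊥-elim (none (i , eᵢ≢0 , eᵢ≢1))
      isZero-injective : ∀ {i j} → isZero (element i) ≡ isZero (element j) → i ≡ j
      isZero-injective {i} {j} same with element i ≟ 0# | element j ≟ 0#
      ... | yes eᵢ≡0 | yes eⱼ≡0 = element-injective (trans eᵢ≡0 (sym eⱼ≡0))
      ... | no eᵢ≢0  | no eⱼ≢0  = element-injective (trans (only-0-1 i eᵢ≢0) (sym (only-0-1 j eⱼ≢0)))
      ... | yes _    | no _     with () ← same
      ... | no _     | yes _    with () ← same

  ⟪⟫-nondegenerate-≢1 : 2 ≤ r → ∀ c → (∀ x → x ≢ 1# → ⟪ c , x ⟫ ≡ false) → c ≡ 0#
  ⟪⟫-nondegenerate-≢1 2≤r c c⊥ = ⟪⟫-nondegenerate c vanishes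
    where
      z : Carrier
      z = proj₁ (third-element 2≤r)
      z≢0 : z ≢ 0#
      z≢0 = proj₁ (proj₂ (third-element 2≤r))
      z≢1 : z ≢ 1#
      z≢1 = proj₂ (proj₂ (third-element 2≤r))
      z+1≢1 : z + 1# ≢ 1#
      z+1≢1 z+1≡1 = z≢0 (trans (sym (x+[x+y]≡y 1# z)) (trans (cong (1# +_) (trans (+-comm 1# z) z+1≡1)) (x+x≡0 1#)))
      -- 1 = z + (z + 1) with neither summand equal to 1.
      vanishes : ∀ y → ⟪ c , y ⟫ ≡ false
      vanishes y with y ≟ 1#
      ... | no y≢1   = c⊥ y y≢1
      ... | yes refl = begin
        ⟪ c , 1# ⟫                         ≡⟨ cong (λ y → ⟪ c , y ⟫) (sym (x+[x+y]≡y z 1#)) ⟩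
        ⟪ c , z + (z + 1#) ⟫               ≡⟨ ⟪⟫-distribʳ c z (z + 1#) ⟩
        ⟪ c , z ⟫ xor ⟪ c , z + 1# ⟫       ≡⟨ cong₂ _xor_ (c⊥ z z≢1) (c⊥ (z + 1#) z+1≢1) ⟩
        false                              ∎

  -- For c ∈ F_q, y (tr (c y) + tr (c y⁻¹)) is the polynomial Σₜ c^(2^t) (y^(2^t + 1) + y^(q - 2^t)),
  -- of degree < q, whose coefficient of y² is c when q ≥ 8.
  module InverseSumPolynomial (3≤r : 3 ≤ r) (c : Carrier) where
    half : ℕ
    half = 2 ^ ℕ.pred r

    q≡half+half : q ≡ half ℕ.+ half
    q≡half+half = trans (cong (2 ^_) (sym (ℕP.suc-pred r {{ℕ.>-nonZero 0<r}}))) (cong (half ℕ.+_) (ℕP.+-identityʳ half))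

    4≤half : 4 ≤ half
    4≤half = ℕP.^-monoʳ-≤ 2 (ℕP.pred-mono-≤ 3≤r)

    2^t≤half : ∀ (t : Fin r) → 2 ^ toℕ t ≤ half
    2^t≤half t = ℕP.^-monoʳ-≤ 2 (ℕP.pred-mono-≤ (FinP.toℕ<n t))

    2^t≤q : ∀ (t : Fin r) → 2 ^ toℕ t ≤ q
    2^t≤q t = ℕP.<⇒≤ (2^t<q t)

    cs : Fin r → Carrier
    cs t = pow c (2 ^ toℕ t)

    e₁ e₂ : Fin r → ℕ
    e₁ t = 2 ^ toℕ t ℕ.+ 1
    e₂ t = q ∸ 2 ^ toℕ t

    e₁-injective : ∀ {t u} → e₁ t ≡ e₁ u → t ≡ u
    e₁-injective = FinP.toℕ-injective ∘ 2^-injective ∘ ℕP.+-cancelʳ-≡ _ _ _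

    e₁<q : ∀ t → e₁ t < q
    e₁<q t = subst (e₁ t <_) (sym q≡half+half) (ℕP.+-mono-≤-< (2^t≤half t) (ℕP.<-≤-trans (s≤s (s≤s z≤n)) 4≤half))

    e₂<q : ∀ t → e₂ t < q
    e₂<q t = ℕP.∸-monoʳ-< {q} {2 ^ toℕ t} {0} (ℕP.m^n>0 2 (toℕ t)) (2^t≤q t)

    4≤e₂ : ∀ t → 4 ≤ e₂ t
    4≤e₂ t = ℕP.≤-trans 4≤half
      (subst (_≤ e₂ t) (trans (cong (_∸ half) q≡half+half) (ℕP.m+n∸n≡m half half)) (ℕP.∸-monoʳ-≤ q (2^t≤half t)))

    t₀ : Fin r
    t₀ = fromℕ< 0<r

    e₁t₀≡2 : e₁ t₀ ≡ 2
    e₁t₀≡2 = cong (λ k → 2 ^ k ℕ.+ 1) (FinP.toℕ-fromℕ< 0<r)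

    polynomialCoefficient : ℕ → Carrier
    polynomialCoefficient k = coefficient cs e₁ k + coefficient cs e₂ k

    polynomialCoefficient-e₁t₀ : polynomialCoefficient (e₁ t₀) ≡ c
    polynomialCoefficient-e₁t₀ = begin
      coefficient cs e₁ (e₁ t₀) + coefficient cs e₂ (e₁ t₀)  ≡⟨ cong₂ _+_ (coefficient-at cs e₁ e₁-injective t₀) none₂ ⟩
      pow c (2 ^ toℕ t₀) + 0#                                ≡⟨ +-identityʳ _ ⟩
      pow c (2 ^ toℕ t₀)                                     ≡⟨ cong (λ k → pow c (2 ^ k)) (FinP.toℕ-fromℕ< 0<r) ⟩
      c * 1#                                                 ≡⟨ *-identityʳ c ⟩
      c                                                      ∎
      where
        e₂≢e₁t₀ : ∀ t → e₂ t ≢ e₁ t₀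
        e₂≢e₁t₀ t e₂≡e₁t₀ = ℕP.<⇒≱ (s≤s (s≤s (s≤s z≤n))) (subst (4 ≤_) (trans e₂≡e₁t₀ e₁t₀≡2) (4≤e₂ t))
        none₂ : coefficient cs e₂ (e₁ t₀) ≡ 0#
        none₂ = sumF-zero r (λ t → trans (cong (_* cs t) (δℕ-≢ (e₂≢e₁t₀ t))) (zeroˡ (cs t)))

    S : (Fin r → ℕ) → Carrier → Carrier
    S e y = sumF r (λ t → cs t * pow y (e t))

    powerSum≡S₁+S₂ : ∀ y → sumF q (λ i → polynomialCoefficient (toℕ i) * pow y (toℕ i)) ≡ S e₁ y + S e₂ y
    powerSum≡S₁+S₂ y = begin
      sumF q (λ i → polynomialCoefficient (toℕ i) * pow y (toℕ i))
        ≡⟨ sumF-cong q (λ i → distribʳ (pow y (toℕ i)) _ _) ⟩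
      sumF q (λ i → coefficient cs e₁ (toℕ i) * pow y (toℕ i) + coefficient cs e₂ (toℕ i) * pow y (toℕ i))
        ≡⟨ sumF-distrib-+ q _ _ ⟩
      sumF q (λ i → coefficient cs e₁ (toℕ i) * pow y (toℕ i)) + sumF q (λ i → coefficient cs e₂ (toℕ i) * pow y (toℕ i))
        ≡⟨ cong₂ _+_ (sparse≡powerSum q cs e₁ e₁<q y) (sparse≡powerSum q cs e₂ e₂<q y) ⟩
      S e₁ y + S e₂ y ∎

    S-at-0 : ∀ e → (∀ t → 0 < e t) → S e 0# ≡ 0#
    S-at-0 e 0<e = sumF-zero r (λ t → trans (cong (cs t *_) (pow-0# (0<e t))) (zeroʳ (cs t)))

    S₁+S₂-at-0 : S e₁ 0# + S e₂ 0# ≡ 0#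
    S₁+S₂-at-0 = trans (cong₂ _+_ (S-at-0 e₁ (λ t → ℕP.m≤n+m 1 _)) (S-at-0 e₂ (λ t → ℕP.<-≤-trans (s≤s z≤n) (4≤e₂ t))))
                       (+-identityʳ 0#)

    S₁+S₂-at-nonzero : ∀ {y} (y≢0 : y ≢ 0#) → S e₁ y + S e₂ y ≡ tr (c * (y + (y ⁻¹) {y≢0})) * y
    S₁+S₂-at-nonzero {y} y≢0 = begin
      S e₁ y + S e₂ y
        ≡⟨ cong₂ _+_ (trans (sumF-cong r monomial₁) (sym (*-distribʳ-sumF r y _)))
                     (trans (sumF-cong r monomial₂) (sym (*-distribʳ-sumF r y _))) ⟩
      tr (c * y) * y + tr (c * y⁻¹) * y      ≡⟨ sym (distribʳ y _ _) ⟩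
      (tr (c * y) + tr (c * y⁻¹)) * y        ≡⟨ cong (_* y) (sym (trans (cong tr (distribˡ c y y⁻¹)) (tr-+ _ _))) ⟩
      tr (c * (y + y⁻¹)) * y                 ∎
      where
        y⁻¹ : Carrier
        y⁻¹ = (y ⁻¹) {y≢0}
        monomial₁ : ∀ t → cs t * pow y (e₁ t) ≡ pow (c * y) (2 ^ toℕ t) * y
        monomial₁ t = begin
          cs t * pow y (2 ^ toℕ t ℕ.+ 1)   ≡⟨ cong (cs t *_) (trans (pow-+ y (2 ^ toℕ t) 1) (cong (pow y (2 ^ toℕ t) *_) (*-identityʳ y))) ⟩
          cs t * (pow y (2 ^ toℕ t) * y)   ≡⟨ sym (*-assoc _ _ y) ⟩
          cs t * pow y (2 ^ toℕ t) * y     ≡⟨ cong (_* y) (sym (pow-distrib-* c y (2 ^ toℕ t))) ⟩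
          pow (c * y) (2 ^ toℕ t) * y      ∎
        monomial₂ : ∀ t → cs t * pow y (e₂ t) ≡ pow (c * y⁻¹) (2 ^ toℕ t) * y
        monomial₂ t = begin
          cs t * pow y (e₂ t)                ≡⟨ cong (cs t *_) (pow-q∸k y≢0 (2 ^ toℕ t) (2^t≤q t)) ⟩
          cs t * (pow y⁻¹ (2 ^ toℕ t) * y)   ≡⟨ sym (*-assoc _ _ y) ⟩
          cs t * pow y⁻¹ (2 ^ toℕ t) * y     ≡⟨ cong (_* y) (sym (pow-distrib-* c y⁻¹ (2 ^ toℕ t))) ⟩
          pow (c * y⁻¹) (2 ^ toℕ t) * y      ∎

  ⟪⟫-nondegenerate-inverseSums : 3 ≤ r → ∀ c → (∀ x → InverseSum x → ⟪ c , x ⟫ ≡ false) → c ≡ 0#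
  ⟪⟫-nondegenerate-inverseSums 3≤r c c⊥ =
    trans (sym polynomialCoefficient-e₁t₀) (powerSum-vanishing polynomialCoefficient vanishes (e₁<q t₀))
    where
      open InverseSumPolynomial 3≤r c
      vanishes : ∀ y → sumF q (λ i → polynomialCoefficient (toℕ i) * pow y (toℕ i)) ≡ 0#
      vanishes y with y ≟ 0#
      ... | yes refl = trans (powerSum≡S₁+S₂ 0#) S₁+S₂-at-0
      ... | no y≢0   = begin
        sumF q (λ i → polynomialCoefficient (toℕ i) * pow y (toℕ i))  ≡⟨ powerSum≡S₁+S₂ y ⟩
        S e₁ y + S e₂ y                                      ≡⟨ S₁+S₂-at-nonzero y≢0 ⟩
        tr (c * (y + (y ⁻¹) {y≢0})) * y                      ≡⟨ cong (_* y) (sym (ι⟪⟫ c _)) ⟩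
        ι ⟪ c , y + (y ⁻¹) {y≢0} ⟫ * y                       ≡⟨ cong (λ b → ι b * y) (c⊥ _ (y , y≢0 , refl)) ⟩
        0# * y                                               ≡⟨ zeroˡ y ⟩
        0#                                                   ∎

  dcIso-n≥2 : ∀ n s → 2 ≤ n → 1 ≤ s → s ≤ n → DCIso n s
  dcIso-n≥2 1 _ (s≤s ())
  dcIso-n≥2 (suc (suc m)) s _ 1≤s s≤n =
    dcIso-fromTraces (suc (suc m)) s (λ _ → ⊤) (λ c c⊥ → ⟪⟫-nondegenerate c (λ y → c⊥ y tt)) (λ x _ → traces-n≥2 1≤s s≤n x)

  dcIso-n∸1 : ∀ n → 2 ≤ n → DCIso n (n ∸ 1)
  dcIso-n∸1 n 2≤n = dcIso-n≥2 n (n ∸ 1) 2≤n (ℕP.m<n⇒0<n∸m 2≤n) (ℕP.m∸n≤m n 1)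

  dcIso-n∸2 : ∀ n → 3 ≤ n → DCIso n (n ∸ 2)
  dcIso-n∸2 n 3≤n = dcIso-n≥2 n (n ∸ 2) (ℕP.<⇒≤ 3≤n) (ℕP.m<n⇒0<n∸m 3≤n) (ℕP.m∸n≤m n 2)

  dcIso-2-0 : 2 ≤ r → DCIso 2 0
  dcIso-2-0 2≤r = dcIso-fromTraces 2 0 (_≢ 1#) (⟪⟫-nondegenerate-≢1 2≤r) traces-2-0

  dcIso-1-0 : 3 ≤ r → DCIso 1 0
  dcIso-1-0 3≤r = dcIso-fromTraces 1 0 InverseSum (⟪⟫-nondegenerate-inverseSums 3≤r) traces-1-0

theorem13 : (r : ℕ) (F : FiniteField2 r) →
    let open FF F in
      (∀ n → Even n → 2 ≤ n → DCIso n (n ∸ 1))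
    × (∀ n → Even n → (4 ≤ n ⊎ (n ≡ 2 × 2 ≤ r)) → DCIso n (n ∸ 2))
    × (∀ n → Odd n → (3 ≤ n ⊎ (n ≡ 1 × 3 ≤ r)) → DCIso n (n ∸ 1))
    × (∀ n → Odd n → 3 ≤ n → DCIso n (n ∸ 2))
theorem13 r F =
    (λ n _ 2≤n → dcIso-n∸1 F n 2≤n)
  , (λ { n _ (inj₁ 4≤n) → dcIso-n∸2 F n (ℕP.<⇒≤ 4≤n) ; n _ (inj₂ (refl , 2≤r)) → dcIso-2-0 F 2≤r })
  , (λ { n _ (inj₁ 3≤n) → dcIso-n∸1 F n (ℕP.<⇒≤ 3≤n) ; n _ (inj₂ (refl , 3≤r)) → dcIso-1-0 F 3≤r })
  , (λ n _ 3≤n → dcIso-n∸2 F n 3≤n)
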